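{- Let $M\in SN$ be a typed term and let $\sigma=[x_i:=N_i\mid i=1,\dots,n]$ be a substitution of intuitionistic variables such that the substituted variables $x_1,\dots,x_n$ all have the same type $A$, each $N_i$ is a typed term of type $A$, and $N_i\in SN$ for all $i$. Then $M[\sigma]\in SN$.
   Context: Formulas: atoms, $\perp$, $\rightarrow,\wedge,\vee$; $\neg A=A\rightarrow\perp$. Intuitionistic variables $x,y,\dots$, classical variables $a,b,\dots$. Terms: ${\cal T} ::= x \mid \lambda x\, {\cal T} \mid ({\cal T}\ {\cal E}) \mid \langle {\cal T},{\cal T}\rangle \mid \omega_1 {\cal T} \mid \omega_2 {\cal T} \mid \mu a\, {\cal T} \mid (a\ {\cal T})$, ${\cal E} ::= {\cal T} \mid \pi_1 \mid \pi_2 \mid [x.{\cal T}, y.{\cal T}]$. Typing (contexts contain $x:A$, $a:\neg A$): $x:A$ for declared $x$; $\langle M,N\rangle:A\wedge B$ from $M:A,N:B$; $(M\ \pi_i):A_i$ from $M:A_1\wedge A_2$; $\lambda xM:A\rightarrow B$ from $M:B$ under $x:A$; $(M\ N):B$ from $M:A\rightarrow B,N:A$; $\omega_iM:A_1\vee A_2$ from $M:A_i$; $(M\ [x_1.N_1,x_2.N_2]):C$ from $M:A_1\vee A_2$ and $N_i:C$ under $x_i:A_i$; $\mu aM:A$ from $M:\perp$ under $a:\neg A$; $(a\ M):\perp$ from $M:A$ under $a:\neg A$. Typed = has a type in some context. Reduction $\triangleright$: compatible closure of $(\lambda x M\ N)\triangleright M[x:=N]$; $(\langle M_1,M_2\rangle\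 \pi_i)\triangleright M_i$; $(\omega_i M\ [x_1.N_1,x_2.N_2])\triangleright N_i[x_i:=M]$; $(M\ [x_1.N_1,x_2.N_2]\ \varepsilon)\triangleright (M\ [x_1.(N_1\ \varepsilon),x_2.(N_2\ \varepsilon)])$; $(\mu a M\ \varepsilon)\triangleright \mu a\, M[a:=^*\varepsilon]$ ($M[a:=^*\varepsilon]$ replaces each subterm $(a\ P)$ by $(a\ (P\ \varepsilon))$). $SN$: no infinite reduction sequence. $M[\sigma]$ is simultaneous capture-avoiding substitution. -}

module Defs where

open import Data.Nat using (ℕ; zero; suc; _≤_; _≡ᵇ_)
open import Data.Bool using (if_then_else_)
open import Data.Maybe using (Maybe; just; nothing; maybe)
open import Data.Product using (∃; ∃-syntax; _×_; _,_)
open import Function using (id; _∘_)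

data Form : Set where
  atom : ℕ → Form
  ⊥ᶠ   : Form
  _⇒_  : Form → Form → Form
  _∧ᶠ_ : Form → Form → Form
  _∨ᶠ_ : Form → Form → Form

infixr 5 _⇒_
infixr 6 _∨ᶠ_
infixr 7 _∧ᶠ_

¬ᶠ_ : Form → Form
¬ᶠ A = A ⇒ ⊥ᶠ

-- Intuitionistic variables (x, y, …)
-- and classical variables (a, b, …) are two separate sorts, each
-- indexed by ℕ.
--   var x       : x
--   lam M       : λx M           (binds intuitionistic variable 0 in M)
--   app M ε     : (M ε)
--   pair M N    : ⟨M , N⟩
--   inj₁ M      : ω₁ M ,   inj₂ M : ω₂ M
--   mu M        : μa M           (binds classical variable 0 in M)
--   cvar a M    : (a M)
-- Eliminators:
--   arg N       : a term N
--   π₁, π₂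
--   case N₁ N₂  : [x.N₁ , y.N₂]  (each branch binds intuitionistic var 0)

mutual
  data Term : Set where
    var  : ℕ → Term
    lam  : Term → Term
    app  : Term → Elim → Term
    pair : Term → Term → Term
    inj₁ : Term → Term
    inj₂ : Term → Term
    mu   : Term → Term
    cvar : ℕ → Term → Term

  data Elim : Set where
    arg  : Term → Elim
    π₁   : Elim
    π₂   : Elim
    case : Term → Term → Elim

lift : (ℕ → ℕ) → ℕ → ℕ
lift ρ zero    = zero
lift ρ (suc n) = suc (ρ n)

mutual
  ren : (ℕ → ℕ) → (ℕ → ℕ) → Term → Term
  ren ρ κ (var x)    = var (ρ x)
  ren ρ κ (lam M)    = lam (ren (lift ρ) κ M)
  ren ρ κ (app M ε)  = app (ren ρ κ M) (renE ρ κ ε)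
  ren ρ κ (pair M N) = pair (ren ρ κ M) (ren ρ κ N)
  ren ρ κ (inj₁ M)   = inj₁ (ren ρ κ M)
  ren ρ κ (inj₂ M)   = inj₂ (ren ρ κ M)
  ren ρ κ (mu M)     = mu (ren ρ (lift κ) M)
  ren ρ κ (cvar a M) = cvar (κ a) (ren ρ κ M)

  renE : (ℕ → ℕ) → (ℕ → ℕ) → Elim → Elim
  renE ρ κ (arg N)      = arg (ren ρ κ N)
  renE ρ κ π₁           = π₁
  renE ρ κ π₂           = π₂
  renE ρ κ (case N₁ N₂) = case (ren (lift ρ) κ N₁) (ren (lift ρ) κ N₂)

↑ⁱ : Term → Term
↑ⁱ = ren suc id

↑ᶜ : Term → Term
↑ᶜ = ren id suc

↑ⁱₑ : Elim → Elim
↑ⁱₑ = renE suc id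

↑ᶜₑ : Elim → Elim
↑ᶜₑ = renE id suc

Subst : Set
Subst = ℕ → Term

exts : Subst → Subst
exts σ zero    = var zero
exts σ (suc x) = ↑ⁱ (σ x)

extsᶜ : Subst → Subst
extsᶜ σ x = ↑ᶜ (σ x)

mutual
  sub : Subst → Term → Term
  sub σ (var x)    = σ x
  sub σ (lam M)    = lam (sub (exts σ) M)
  sub σ (app M ε)  = app (sub σ M) (subE σ ε)
  sub σ (pair M N) = pair (sub σ M) (sub σ N)
  sub σ (inj₁ M)   = inj₁ (sub σ M)
  sub σ (inj₂ M)   = inj₂ (sub σ M)
  sub σ (mu M)     = mu (sub (extsᶜ σ) M)
  sub σ (cvar a M) = cvar a (sub σ M)

  subE : Subst → Elim → Elim
  subE σ (arg N)      = arg (sub σ N)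
  subE σ π₁           = π₁
  subE σ π₂           = π₂
  subE σ (case N₁ N₂) = case (sub (exts σ) N₁) (sub (exts σ) N₂)

_[0:=_] : Term → Term → Term
M [0:= N ] = sub σ M
  where
  σ : Subst
  σ zero    = N
  σ (suc x) = var x

PSubst : Set
PSubst = ℕ → Maybe Term

toSubst : PSubst → Subst
toSubst σ x = maybe id (var x) (σ x)

_[_] : Term → PSubst → Term
M [ σ ] = sub (toSubst σ) M

mutual
  sstr : ℕ → Elim → Term → Term
  sstr a ε (var x)    = var x
  sstr a ε (lam M)    = lam (sstr a (↑ⁱₑ ε) M)
  sstr a ε (app M e)  = app (sstr a ε M) (sstrE a ε e)
  sstr a ε (pair M N) = pair (sstr a ε M) (sstr a ε N)
  sstr a ε (inj₁ M)   = inj₁ (sstr a ε M)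
  sstr a ε (inj₂ M)   = inj₂ (sstr a ε M)
  sstr a ε (mu M)     = mu (sstr (suc a) (↑ᶜₑ ε) M)
  sstr a ε (cvar b M) =
    if b ≡ᵇ a then cvar b (app (sstr a ε M) ε) else cvar b (sstr a ε M)

  sstrE : ℕ → Elim → Elim → Elim
  sstrE a ε (arg N)      = arg (sstr a ε N)
  sstrE a ε π₁           = π₁
  sstrE a ε π₂           = π₂
  sstrE a ε (case N₁ N₂) = case (sstr a (↑ⁱₑ ε) N₁) (sstr a (↑ⁱₑ ε) N₂)

infix 4 _▷_ _▷ₑ_

mutual
  data _▷_ : Term → Term → Set where
    β     : ∀ {M N} → app (lam M) (arg N) ▷ M [0:= N ]
    π₁β   : ∀ {M₁ M₂} → app (pair M₁ M₂) π₁ ▷ M₁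
    π₂β   : ∀ {M₁ M₂} → app (pair M₁ M₂) π₂ ▷ M₂
    ω₁β   : ∀ {M N₁ N₂} → app (inj₁ M) (case N₁ N₂) ▷ N₁ [0:= M ]
    ω₂β   : ∀ {M N₁ N₂} → app (inj₂ M) (case N₁ N₂) ▷ N₂ [0:= M ]
    comm  : ∀ {M N₁ N₂ ε} →
            app (app M (case N₁ N₂)) ε ▷
            app M (case (app N₁ (↑ⁱₑ ε)) (app N₂ (↑ⁱₑ ε)))
    μβ    : ∀ {M ε} → app (mu M) ε ▷ mu (sstr zero (↑ᶜₑ ε) M)
    lam-c  : ∀ {M M'} → M ▷ M' → lam M ▷ lam M'
    appˡ   : ∀ {M M' ε} → M ▷ M' → app M ε ▷ app M' ε
    appʳ   : ∀ {M ε ε'} → ε ▷ₑ ε' → app M ε ▷ app M ε'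
    pairˡ  : ∀ {M M' N} → M ▷ M' → pair M N ▷ pair M' N
    pairʳ  : ∀ {M N N'} → N ▷ N' → pair M N ▷ pair M N'
    inj₁-c : ∀ {M M'} → M ▷ M' → inj₁ M ▷ inj₁ M'
    inj₂-c : ∀ {M M'} → M ▷ M' → inj₂ M ▷ inj₂ M'
    mu-c   : ∀ {M M'} → M ▷ M' → mu M ▷ mu M'
    cvar-c : ∀ {a M M'} → M ▷ M' → cvar a M ▷ cvar a M'

  data _▷ₑ_ : Elim → Elim → Set where
    arg-c  : ∀ {N N'} → N ▷ N' → arg N ▷ₑ arg N'
    caseˡ  : ∀ {N₁ N₁' N₂} → N₁ ▷ N₁' → case N₁ N₂ ▷ₑ case N₁' N₂
    caseʳ  : ∀ {N₁ N₂ N₂'} → N₂ ▷ N₂' → case N₁ N₂ ▷ₑ case N₁ N₂'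

data SN (M : Term) : Set where
  sn : (∀ {N} → M ▷ N → SN N) → SN M

-- Typing.  Γ gives the type of each intuitionistic variable; Δ a = A
-- means the classical variable a has type ¬A.

Ctx : Set
Ctx = ℕ → Form

_,,_ : Ctx → Form → Ctx
(Γ ,, A) zero    = A
(Γ ,, A) (suc x) = Γ x

infix 3 _∣_⊢_∶_

data _∣_⊢_∶_ : Ctx → Ctx → Term → Form → Set where
  ⊢var  : ∀ {Γ Δ x} → Γ ∣ Δ ⊢ var x ∶ Γ x
  ⊢pair : ∀ {Γ Δ M N A B} → Γ ∣ Δ ⊢ M ∶ A → Γ ∣ Δ ⊢ N ∶ B →
          Γ ∣ Δ ⊢ pair M N ∶ A ∧ᶠ B
  ⊢π₁   : ∀ {Γ Δ M A B} → Γ ∣ Δ ⊢ M ∶ A ∧ᶠ B → Γ ∣ Δ ⊢ app M π₁ ∶ A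
  ⊢π₂   : ∀ {Γ Δ M A B} → Γ ∣ Δ ⊢ M ∶ A ∧ᶠ B → Γ ∣ Δ ⊢ app M π₂ ∶ B
  ⊢lam  : ∀ {Γ Δ M A B} → (Γ ,, A) ∣ Δ ⊢ M ∶ B → Γ ∣ Δ ⊢ lam M ∶ A ⇒ B
  ⊢app  : ∀ {Γ Δ M N A B} → Γ ∣ Δ ⊢ M ∶ A ⇒ B → Γ ∣ Δ ⊢ N ∶ A →
          Γ ∣ Δ ⊢ app M (arg N) ∶ B
  ⊢inj₁ : ∀ {Γ Δ M A B} → Γ ∣ Δ ⊢ M ∶ A → Γ ∣ Δ ⊢ inj₁ M ∶ A ∨ᶠ B
  ⊢inj₂ : ∀ {Γ Δ M A B} → Γ ∣ Δ ⊢ M ∶ B → Γ ∣ Δ ⊢ inj₂ M ∶ A ∨ᶠ B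
  ⊢case : ∀ {Γ Δ M N₁ N₂ A B C} → Γ ∣ Δ ⊢ M ∶ A ∨ᶠ B →
          (Γ ,, A) ∣ Δ ⊢ N₁ ∶ C → (Γ ,, B) ∣ Δ ⊢ N₂ ∶ C →
          Γ ∣ Δ ⊢ app M (case N₁ N₂) ∶ C
  ⊢mu   : ∀ {Γ Δ M A} → Γ ∣ (Δ ,, A) ⊢ M ∶ ⊥ᶠ → Γ ∣ Δ ⊢ mu M ∶ A
  ⊢cvar : ∀ {Γ Δ a M} → Γ ∣ Δ ⊢ M ∶ Δ a → Γ ∣ Δ ⊢ cvar a M ∶ ⊥ᶠ

TypedAs : Term → Form → Set
TypedAs N A = ∃[ Γ ] ∃[ Δ ] (Γ ∣ Δ ⊢ N ∶ A)

FiniteDom : PSubst → Set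
FiniteDom σ = ∃[ k ] (∀ x → k ≤ x → σ x ≡ nothing)
  where open import Relation.Binary.PropositionalEquality using (_≡_)

-- The argument is reducibility with stacks: an A-stack is a list of
-- eliminators able to consume a term of type A (reducible arguments,
-- projections, and case branches that are SN whenever their variable is
-- instantiated by a reducible term), and a term is reducible of type A when
-- it is SN in front of every A-stack.  Since a μβ step hands the stack to
-- every (a P) in the body of μa M, the fundamental lemma is proved for
-- substitutions that simultaneously replace intuitionistic variables by
-- reducible terms and append A-stacks to classical variables of type ¬A.
-- Each typing rule is then closed by a head expansion lemma for its redex.

module Submission where

open import Defs
open import Data.Nat using (ℕ; zero; suc; _≤_; s≤s; _≡ᵇ_)
open import Data.Nat.Properties using (≤-refl; ≤-trans; n≤1+n)
open import Data.Bool using (Bool; true; false; if_then_else_)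
open import Data.Maybe using (just; nothing)
open import Data.Product using (Σ; _×_; _,_; proj₁; proj₂)
open import Data.Sum using (_⊎_) renaming (inj₁ to left; inj₂ to right)
open import Data.List using (List; []; _∷_; map; _++_; foldl; length)
open import Data.List.Properties using (map-cong; map-∘; map-id; map-++; ++-identityʳ; foldl-++)
open import Data.Empty using (⊥)
open import Data.Unit using (⊤; tt)
open import Function using (id; _∘_)
open import Relation.Binary.PropositionalEquality
  using (_≡_; _≗_; refl; sym; trans; cong; cong₂; subst; subst₂; module ≡-Reasoning)
open import Relation.Binary.Construct.Closure.ReflexiveTransitive
  using (Star; ε; _◅_; _◅◅_; gmap)

Stack : Set
Stack = List Elim

infixl 5 _·_
_·_ : Term → Stack → Term
_·_ = foldl app

StackSubst : Set
StackSubst = ℕ → Stack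

nilˢ : StackSubst
nilˢ _ = []

extsˢ : StackSubst → StackSubst
extsˢ τ b = map ↑ⁱₑ (τ b)

extsᶜˢ : StackSubst → StackSubst
extsᶜˢ τ zero    = []
extsᶜˢ τ (suc b) = map ↑ᶜₑ (τ b)

-- It
-- subsumes sub, ren and the structural substitution sstr, and it is closed
-- under composition, which sstr alone is not.
mutual
  subs : Subst → (ℕ → ℕ) → StackSubst → Term → Term
  subs σ κ τ (var x)    = σ x
  subs σ κ τ (lam M)    = lam (subs (exts σ) κ (extsˢ τ) M)
  subs σ κ τ (app M e)  = app (subs σ κ τ M) (subsE σ κ τ e)
  subs σ κ τ (pair M N) = pair (subs σ κ τ M) (subs σ κ τ N)
  subs σ κ τ (inj₁ M)   = inj₁ (subs σ κ τ M)
  subs σ κ τ (inj₂ M)   = inj₂ (subs σ κ τ M)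
  subs σ κ τ (mu M)     = mu (subs (extsᶜ σ) (lift κ) (extsᶜˢ τ) M)
  subs σ κ τ (cvar a M) = cvar (κ a) (subs σ κ τ M · τ a)

  subsE : Subst → (ℕ → ℕ) → StackSubst → Elim → Elim
  subsE σ κ τ (arg N)      = arg (subs σ κ τ N)
  subsE σ κ τ π₁           = π₁
  subsE σ κ τ π₂           = π₂
  subsE σ κ τ (case N₁ N₂) = case (subs (exts σ) κ (extsˢ τ) N₁) (subs (exts σ) κ (extsˢ τ) N₂)

subs-· : ∀ {σ κ τ} M s → subs σ κ τ (M · s) ≡ subs σ κ τ M · map (subsE σ κ τ) s
subs-· M []      = refl
subs-· M (e ∷ s) = subs-· (app M e) s

map-fuse : ∀ {f g h : Elim → Elim} → (∀ e → f (g e) ≡ h e) → ∀ s → map f (map g s) ≡ map h s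
map-fuse p s = trans (sym (map-∘ s)) (map-cong p s)

map-comm : ∀ {f g h k : Elim → Elim} → (∀ e → f (g e) ≡ h (k e)) →
           ∀ s → map f (map g s) ≡ map h (map k s)
map-comm p s = trans (map-fuse p s) (map-∘ s)

exts-cong : ∀ {σ σ'} → σ ≗ σ' → exts σ ≗ exts σ'
exts-cong h zero    = refl
exts-cong h (suc x) = cong ↑ⁱ (h x)

extsᶜ-cong : ∀ {σ σ'} → σ ≗ σ' → extsᶜ σ ≗ extsᶜ σ'
extsᶜ-cong h x = cong ↑ᶜ (h x)

lift-cong : ∀ {κ κ'} → κ ≗ κ' → lift κ ≗ lift κ'
lift-cong h zero    = refl
lift-cong h (suc x) = cong suc (h x)

extsˢ-cong : ∀ {τ τ'} → τ ≗ τ' → extsˢ τ ≗ extsˢ τ'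
extsˢ-cong h b = cong (map ↑ⁱₑ) (h b)

extsᶜˢ-cong : ∀ {τ τ'} → τ ≗ τ' → extsᶜˢ τ ≗ extsᶜˢ τ'
extsᶜˢ-cong h zero    = refl
extsᶜˢ-cong h (suc b) = cong (map ↑ᶜₑ) (h b)

mutual
  subs-cong : ∀ {σ σ' κ κ' τ τ'} → σ ≗ σ' → κ ≗ κ' → τ ≗ τ' → subs σ κ τ ≗ subs σ' κ' τ'
  subs-cong hσ hκ hτ (var x)    = hσ x
  subs-cong hσ hκ hτ (lam M)    = cong lam (subs-cong (exts-cong hσ) hκ (extsˢ-cong hτ) M)
  subs-cong hσ hκ hτ (app M e)  = cong₂ app (subs-cong hσ hκ hτ M) (subsE-cong hσ hκ hτ e)
  subs-cong hσ hκ hτ (pair M N) = cong₂ pair (subs-cong hσ hκ hτ M) (subs-cong hσ hκ hτ N)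
  subs-cong hσ hκ hτ (inj₁ M)   = cong inj₁ (subs-cong hσ hκ hτ M)
  subs-cong hσ hκ hτ (inj₂ M)   = cong inj₂ (subs-cong hσ hκ hτ M)
  subs-cong hσ hκ hτ (mu M)     = cong mu (subs-cong (extsᶜ-cong hσ) (lift-cong hκ) (extsᶜˢ-cong hτ) M)
  subs-cong hσ hκ hτ (cvar a M) = cong₂ cvar (hκ a) (cong₂ _·_ (subs-cong hσ hκ hτ M) (hτ a))

  subsE-cong : ∀ {σ σ' κ κ' τ τ'} → σ ≗ σ' → κ ≗ κ' → τ ≗ τ' → subsE σ κ τ ≗ subsE σ' κ' τ'
  subsE-cong hσ hκ hτ (arg N)      = cong arg (subs-cong hσ hκ hτ N)
  subsE-cong hσ hκ hτ π₁           = refl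
  subsE-cong hσ hκ hτ π₂           = refl
  subsE-cong hσ hκ hτ (case N₁ N₂) =
    cong₂ case (subs-cong (exts-cong hσ) hκ (extsˢ-cong hτ) N₁) (subs-cong (exts-cong hσ) hκ (extsˢ-cong hτ) N₂)

IsRen : Subst → (ℕ → ℕ) → Set
IsRen σ ρ = ∀ x → σ x ≡ var (ρ x)

IsNil : StackSubst → Set
IsNil τ = ∀ b → τ b ≡ []

exts-IsRen : ∀ {σ ρ} → IsRen σ ρ → IsRen (exts σ) (lift ρ)
exts-IsRen h zero    = refl
exts-IsRen h (suc x) = cong ↑ⁱ (h x)

extsᶜ-IsRen : ∀ {σ ρ} → IsRen σ ρ → IsRen (extsᶜ σ) ρ
extsᶜ-IsRen h x = cong ↑ᶜ (h x)

extsˢ-IsNil : ∀ {τ} → IsNil τ → IsNil (extsˢ τ)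
extsˢ-IsNil h b = cong (map ↑ⁱₑ) (h b)

extsᶜˢ-IsNil : ∀ {τ} → IsNil τ → IsNil (extsᶜˢ τ)
extsᶜˢ-IsNil h zero    = refl
extsᶜˢ-IsNil h (suc b) = cong (map ↑ᶜₑ) (h b)

lift-id : ∀ {κ} → κ ≗ id → lift κ ≗ id
lift-id h zero    = refl
lift-id h (suc x) = cong suc (h x)

exts-IsRen-id : ∀ {σ} → IsRen σ id → IsRen (exts σ) id
exts-IsRen-id h x = trans (exts-IsRen h x) (cong var (lift-id (λ _ → refl) x))

mutual
  ren-as-subs : ∀ {ρ κ σ κ' τ} → IsRen σ ρ → κ ≗ κ' → IsNil τ → ∀ M → ren ρ κ M ≡ subs σ κ' τ M
  ren-as-subs hσ hκ hτ (var x)    = sym (hσ x)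
  ren-as-subs hσ hκ hτ (lam M)    = cong lam (ren-as-subs (exts-IsRen hσ) hκ (extsˢ-IsNil hτ) M)
  ren-as-subs hσ hκ hτ (app M e)  = cong₂ app (ren-as-subs hσ hκ hτ M) (renE-as-subsE hσ hκ hτ e)
  ren-as-subs hσ hκ hτ (pair M N) = cong₂ pair (ren-as-subs hσ hκ hτ M) (ren-as-subs hσ hκ hτ N)
  ren-as-subs hσ hκ hτ (inj₁ M)   = cong inj₁ (ren-as-subs hσ hκ hτ M)
  ren-as-subs hσ hκ hτ (inj₂ M)   = cong inj₂ (ren-as-subs hσ hκ hτ M)
  ren-as-subs hσ hκ hτ (mu M)     =
    cong mu (ren-as-subs (extsᶜ-IsRen hσ) (lift-cong hκ) (extsᶜˢ-IsNil hτ) M)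
  ren-as-subs hσ hκ hτ (cvar a M) rewrite hτ a = cong₂ cvar (hκ a) (ren-as-subs hσ hκ hτ M)

  renE-as-subsE : ∀ {ρ κ σ κ' τ} → IsRen σ ρ → κ ≗ κ' → IsNil τ → ∀ e → renE ρ κ e ≡ subsE σ κ' τ e
  renE-as-subsE hσ hκ hτ (arg N)      = cong arg (ren-as-subs hσ hκ hτ N)
  renE-as-subsE hσ hκ hτ π₁           = refl
  renE-as-subsE hσ hκ hτ π₂           = refl
  renE-as-subsE hσ hκ hτ (case N₁ N₂) =
    cong₂ case (ren-as-subs (exts-IsRen hσ) hκ (extsˢ-IsNil hτ) N₁)
               (ren-as-subs (exts-IsRen hσ) hκ (extsˢ-IsNil hτ) N₂)

mutual
  sub-as-subs : ∀ {σ σ' κ τ} → σ ≗ σ' → κ ≗ id → IsNil τ → ∀ M → sub σ M ≡ subs σ' κ τ M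
  sub-as-subs hσ hκ hτ (var x)    = hσ x
  sub-as-subs hσ hκ hτ (lam M)    = cong lam (sub-as-subs (exts-cong hσ) hκ (extsˢ-IsNil hτ) M)
  sub-as-subs hσ hκ hτ (app M e)  = cong₂ app (sub-as-subs hσ hκ hτ M) (subE-as-subsE hσ hκ hτ e)
  sub-as-subs hσ hκ hτ (pair M N) = cong₂ pair (sub-as-subs hσ hκ hτ M) (sub-as-subs hσ hκ hτ N)
  sub-as-subs hσ hκ hτ (inj₁ M)   = cong inj₁ (sub-as-subs hσ hκ hτ M)
  sub-as-subs hσ hκ hτ (inj₂ M)   = cong inj₂ (sub-as-subs hσ hκ hτ M)
  sub-as-subs hσ hκ hτ (mu M)     =
    cong mu (sub-as-subs (extsᶜ-cong hσ) (lift-id hκ) (extsᶜˢ-IsNil hτ) M)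
  sub-as-subs hσ hκ hτ (cvar a M) rewrite hτ a = cong₂ cvar (sym (hκ a)) (sub-as-subs hσ hκ hτ M)

  subE-as-subsE : ∀ {σ σ' κ τ} → σ ≗ σ' → κ ≗ id → IsNil τ → ∀ e → subE σ e ≡ subsE σ' κ τ e
  subE-as-subsE hσ hκ hτ (arg N)      = cong arg (sub-as-subs hσ hκ hτ N)
  subE-as-subsE hσ hκ hτ π₁           = refl
  subE-as-subsE hσ hκ hτ π₂           = refl
  subE-as-subsE hσ hκ hτ (case N₁ N₂) =
    cong₂ case (sub-as-subs (exts-cong hσ) hκ (extsˢ-IsNil hτ) N₁)
               (sub-as-subs (exts-cong hσ) hκ (extsˢ-IsNil hτ) N₂)

mutual
  subs-id : ∀ {σ κ τ} → IsRen σ id → κ ≗ id → IsNil τ → ∀ M → subs σ κ τ M ≡ M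
  subs-id hσ hκ hτ (var x)    = hσ x
  subs-id hσ hκ hτ (lam M)    = cong lam (subs-id (exts-IsRen-id hσ) hκ (extsˢ-IsNil hτ) M)
  subs-id hσ hκ hτ (app M e)  = cong₂ app (subs-id hσ hκ hτ M) (subsE-id hσ hκ hτ e)
  subs-id hσ hκ hτ (pair M N) = cong₂ pair (subs-id hσ hκ hτ M) (subs-id hσ hκ hτ N)
  subs-id hσ hκ hτ (inj₁ M)   = cong inj₁ (subs-id hσ hκ hτ M)
  subs-id hσ hκ hτ (inj₂ M)   = cong inj₂ (subs-id hσ hκ hτ M)
  subs-id hσ hκ hτ (mu M)     = cong mu (subs-id (extsᶜ-IsRen hσ) (lift-id hκ) (extsᶜˢ-IsNil hτ) M)
  subs-id hσ hκ hτ (cvar a M) rewrite hτ a = cong₂ cvar (hκ a) (subs-id hσ hκ hτ M)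

  subsE-id : ∀ {σ κ τ} → IsRen σ id → κ ≗ id → IsNil τ → ∀ e → subsE σ κ τ e ≡ e
  subsE-id hσ hκ hτ (arg N)      = cong arg (subs-id hσ hκ hτ N)
  subsE-id hσ hκ hτ π₁           = refl
  subsE-id hσ hκ hτ π₂           = refl
  subsE-id hσ hκ hτ (case N₁ N₂) =
    cong₂ case (subs-id (exts-IsRen-id hσ) hκ (extsˢ-IsNil hτ) N₁)
               (subs-id (exts-IsRen-id hσ) hκ (extsˢ-IsNil hτ) N₂)

subs-var : ∀ M → subs var id nilˢ M ≡ M
subs-var = subs-id (λ _ → refl) (λ _ → refl) (λ _ → refl)

↑ⁱ-as-subs : ∀ M → ↑ⁱ M ≡ subs (var ∘ suc) id nilˢ M
↑ⁱ-as-subs = ren-as-subs (λ _ → refl) (λ _ → refl) (λ _ → refl)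

↑ⁱₑ-as-subsE : ∀ e → ↑ⁱₑ e ≡ subsE (var ∘ suc) id nilˢ e
↑ⁱₑ-as-subsE = renE-as-subsE (λ _ → refl) (λ _ → refl) (λ _ → refl)

↑ᶜ-as-subs : ∀ M → ↑ᶜ M ≡ subs var suc nilˢ M
↑ᶜ-as-subs = ren-as-subs (λ _ → refl) (λ _ → refl) (λ _ → refl)

↑ᶜₑ-as-subsE : ∀ e → ↑ᶜₑ e ≡ subsE var suc nilˢ e
↑ᶜₑ-as-subsE = renE-as-subsE (λ _ → refl) (λ _ → refl) (λ _ → refl)

lift-∘ : ∀ (κ₂ κ₁ : ℕ → ℕ) → lift κ₂ ∘ lift κ₁ ≗ lift (κ₂ ∘ κ₁)
lift-∘ κ₂ κ₁ zero    = refl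
lift-∘ κ₂ κ₁ (suc x) = refl

exts-∘-lift : ∀ (σ : Subst) ρ → exts σ ∘ lift ρ ≗ exts (σ ∘ ρ)
exts-∘-lift σ ρ zero    = refl
exts-∘-lift σ ρ (suc x) = refl

extsᶜˢ-∘-lift : ∀ (τ : StackSubst) κ → extsᶜˢ τ ∘ lift κ ≗ extsᶜˢ (τ ∘ κ)
extsᶜˢ-∘-lift τ κ zero    = refl
extsᶜˢ-∘-lift τ κ (suc x) = refl

mutual
  subs∘ren : ∀ {σ₁ κ₁ τ₁ ρ σ₂ κ₂ τ₂} → IsRen σ₁ ρ → IsNil τ₁ → ∀ M →
             subs σ₂ κ₂ τ₂ (subs σ₁ κ₁ τ₁ M) ≡ subs (σ₂ ∘ ρ) (κ₂ ∘ κ₁) (τ₂ ∘ κ₁) M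
  subs∘ren {σ₂ = σ₂} hσ hτ (var x) = cong (subs σ₂ _ _) (hσ x)
  subs∘ren hσ hτ (lam M)    = cong lam (subs∘ren-exts hσ hτ M)
  subs∘ren hσ hτ (app M e)  = cong₂ app (subs∘ren hσ hτ M) (subsE∘ren hσ hτ e)
  subs∘ren hσ hτ (pair M N) = cong₂ pair (subs∘ren hσ hτ M) (subs∘ren hσ hτ N)
  subs∘ren hσ hτ (inj₁ M)   = cong inj₁ (subs∘ren hσ hτ M)
  subs∘ren hσ hτ (inj₂ M)   = cong inj₂ (subs∘ren hσ hτ M)
  subs∘ren {κ₁ = κ₁} {κ₂ = κ₂} {τ₂ = τ₂} hσ hτ (mu M) =
    cong mu (trans (subs∘ren (extsᶜ-IsRen hσ) (extsᶜˢ-IsNil hτ) M)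
                   (subs-cong (λ _ → refl) (lift-∘ κ₂ κ₁) (extsᶜˢ-∘-lift τ₂ κ₁) M))
  subs∘ren {κ₁ = κ₁} {κ₂ = κ₂} {τ₂ = τ₂} hσ hτ (cvar a M) rewrite hτ a =
    cong (λ X → cvar (κ₂ (κ₁ a)) (X · τ₂ (κ₁ a))) (subs∘ren hσ hτ M)

  subsE∘ren : ∀ {σ₁ κ₁ τ₁ ρ σ₂ κ₂ τ₂} → IsRen σ₁ ρ → IsNil τ₁ → ∀ e →
              subsE σ₂ κ₂ τ₂ (subsE σ₁ κ₁ τ₁ e) ≡ subsE (σ₂ ∘ ρ) (κ₂ ∘ κ₁) (τ₂ ∘ κ₁) e
  subsE∘ren hσ hτ (arg N)      = cong arg (subs∘ren hσ hτ N)
  subsE∘ren hσ hτ π₁           = refl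
  subsE∘ren hσ hτ π₂           = refl
  subsE∘ren hσ hτ (case N₁ N₂) = cong₂ case (subs∘ren-exts hσ hτ N₁) (subs∘ren-exts hσ hτ N₂)

  subs∘ren-exts : ∀ {σ₁ κ₁ τ₁ ρ σ₂ κ₂ τ₂} → IsRen σ₁ ρ → IsNil τ₁ → ∀ M →
                  subs (exts σ₂) κ₂ (extsˢ τ₂) (subs (exts σ₁) κ₁ (extsˢ τ₁) M)
                  ≡ subs (exts (σ₂ ∘ ρ)) (κ₂ ∘ κ₁) (extsˢ (τ₂ ∘ κ₁)) M
  subs∘ren-exts {ρ = ρ} {σ₂ = σ₂} hσ hτ M =
    trans (subs∘ren (exts-IsRen hσ) (extsˢ-IsNil hτ) M)
          (subs-cong (exts-∘-lift σ₂ ρ) (λ _ → refl) (λ _ → refl) M)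

subs-↑ⁱ : ∀ {σ κ τ} M → subs σ κ τ (↑ⁱ M) ≡ subs (σ ∘ suc) κ τ M
subs-↑ⁱ {σ} {κ} {τ} M = trans (cong (subs σ κ τ) (↑ⁱ-as-subs M)) (subs∘ren (λ _ → refl) (λ _ → refl) M)

subsE-↑ⁱₑ : ∀ {σ κ τ} e → subsE σ κ τ (↑ⁱₑ e) ≡ subsE (σ ∘ suc) κ τ e
subsE-↑ⁱₑ {σ} {κ} {τ} e = trans (cong (subsE σ κ τ) (↑ⁱₑ-as-subsE e)) (subsE∘ren (λ _ → refl) (λ _ → refl) e)

subs-↑ᶜ : ∀ {σ κ τ} M → subs σ κ τ (↑ᶜ M) ≡ subs σ (κ ∘ suc) (τ ∘ suc) M
subs-↑ᶜ {σ} {κ} {τ} M = trans (cong (subs σ κ τ) (↑ᶜ-as-subs M)) (subs∘ren (λ _ → refl) (λ _ → refl) M)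

subsE-↑ᶜₑ : ∀ {σ κ τ} e → subsE σ κ τ (↑ᶜₑ e) ≡ subsE σ (κ ∘ suc) (τ ∘ suc) e
subsE-↑ᶜₑ {σ} {κ} {τ} e = trans (cong (subsE σ κ τ) (↑ᶜₑ-as-subsE e)) (subsE∘ren (λ _ → refl) (λ _ → refl) e)

↑ⁱ-comm-ren : ∀ {σ κ τ ρ} → IsRen σ ρ → IsNil τ → ∀ M →
              subs (exts σ) κ (extsˢ τ) (↑ⁱ M) ≡ ↑ⁱ (subs σ κ τ M)
↑ⁱ-comm-ren hσ hτ M =
  trans (subs-↑ⁱ M)
  (trans (subs-cong (λ y → cong ↑ⁱ (hσ y)) (λ _ → refl) (extsˢ-IsNil hτ) M)
  (trans (sym (subs∘ren hσ hτ M)) (sym (↑ⁱ-as-subs _))))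

↑ⁱₑ-comm-ren : ∀ {σ κ τ ρ} → IsRen σ ρ → IsNil τ → ∀ e →
               subsE (exts σ) κ (extsˢ τ) (↑ⁱₑ e) ≡ ↑ⁱₑ (subsE σ κ τ e)
↑ⁱₑ-comm-ren hσ hτ e =
  trans (subsE-↑ⁱₑ e)
  (trans (subsE-cong (λ y → cong ↑ⁱ (hσ y)) (λ _ → refl) (extsˢ-IsNil hτ) e)
  (trans (sym (subsE∘ren hσ hτ e)) (sym (↑ⁱₑ-as-subsE _))))

↑ᶜ-comm-ren : ∀ {σ κ τ ρ} → IsRen σ ρ → IsNil τ → ∀ M →
              subs (extsᶜ σ) (lift κ) (extsᶜˢ τ) (↑ᶜ M) ≡ ↑ᶜ (subs σ κ τ M)
↑ᶜ-comm-ren hσ hτ M =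
  trans (subs-↑ᶜ M)
  (trans (subs-cong (extsᶜ-IsRen hσ) (λ _ → refl) (λ b → extsᶜˢ-IsNil hτ (suc b)) M)
  (trans (sym (subs∘ren hσ hτ M)) (sym (↑ᶜ-as-subs _))))

↑ᶜₑ-comm-ren : ∀ {σ κ τ ρ} → IsRen σ ρ → IsNil τ → ∀ e →
               subsE (extsᶜ σ) (lift κ) (extsᶜˢ τ) (↑ᶜₑ e) ≡ ↑ᶜₑ (subsE σ κ τ e)
↑ᶜₑ-comm-ren hσ hτ e =
  trans (subsE-↑ᶜₑ e)
  (trans (subsE-cong (extsᶜ-IsRen hσ) (λ _ → refl) (λ b → extsᶜˢ-IsNil hτ (suc b)) e)
  (trans (sym (subsE∘ren hσ hτ e)) (sym (↑ᶜₑ-as-subsE _))))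

mutual
  ren∘subs : ∀ {σ₁ κ₁ τ₁ ρ σ₂ κ₂ τ₂} → IsRen σ₂ ρ → IsNil τ₂ → ∀ M →
             subs σ₂ κ₂ τ₂ (subs σ₁ κ₁ τ₁ M)
             ≡ subs (subs σ₂ κ₂ τ₂ ∘ σ₁) (κ₂ ∘ κ₁) (map (subsE σ₂ κ₂ τ₂) ∘ τ₁) M
  ren∘subs hσ hτ (var x)    = refl
  ren∘subs hσ hτ (lam M)    = cong lam (ren∘subs-exts hσ hτ M)
  ren∘subs hσ hτ (app M e)  = cong₂ app (ren∘subs hσ hτ M) (ren∘subsE hσ hτ e)
  ren∘subs hσ hτ (pair M N) = cong₂ pair (ren∘subs hσ hτ M) (ren∘subs hσ hτ N)
  ren∘subs hσ hτ (inj₁ M)   = cong inj₁ (ren∘subs hσ hτ M)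
  ren∘subs hσ hτ (inj₂ M)   = cong inj₂ (ren∘subs hσ hτ M)
  ren∘subs {σ₁} {κ₁} {τ₁} {κ₂ = κ₂} hσ hτ (mu M) =
    cong mu (trans (ren∘subs (extsᶜ-IsRen hσ) (extsᶜˢ-IsNil hτ) M)
      (subs-cong (λ x → ↑ᶜ-comm-ren {κ = κ₂} hσ hτ (σ₁ x)) (lift-∘ κ₂ κ₁)
                 (λ { zero → refl ; (suc b) → map-comm (↑ᶜₑ-comm-ren {κ = κ₂} hσ hτ) (τ₁ b) }) M))
  ren∘subs {σ₁} {κ₁} {τ₁} hσ hτ (cvar a M) rewrite hτ (κ₁ a) =
    cong (cvar _) (trans (subs-· (subs σ₁ κ₁ τ₁ M) (τ₁ a)) (cong (_· map _ (τ₁ a)) (ren∘subs hσ hτ M)))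

  ren∘subsE : ∀ {σ₁ κ₁ τ₁ ρ σ₂ κ₂ τ₂} → IsRen σ₂ ρ → IsNil τ₂ → ∀ e →
              subsE σ₂ κ₂ τ₂ (subsE σ₁ κ₁ τ₁ e)
              ≡ subsE (subs σ₂ κ₂ τ₂ ∘ σ₁) (κ₂ ∘ κ₁) (map (subsE σ₂ κ₂ τ₂) ∘ τ₁) e
  ren∘subsE hσ hτ (arg N)      = cong arg (ren∘subs hσ hτ N)
  ren∘subsE hσ hτ π₁           = refl
  ren∘subsE hσ hτ π₂           = refl
  ren∘subsE hσ hτ (case N₁ N₂) = cong₂ case (ren∘subs-exts hσ hτ N₁) (ren∘subs-exts hσ hτ N₂)

  ren∘subs-exts : ∀ {σ₁ κ₁ τ₁ ρ σ₂ κ₂ τ₂} → IsRen σ₂ ρ → IsNil τ₂ → ∀ M →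
                  subs (exts σ₂) κ₂ (extsˢ τ₂) (subs (exts σ₁) κ₁ (extsˢ τ₁) M)
                  ≡ subs (exts (subs σ₂ κ₂ τ₂ ∘ σ₁)) (κ₂ ∘ κ₁) (extsˢ (map (subsE σ₂ κ₂ τ₂) ∘ τ₁)) M
  ren∘subs-exts {σ₁} {τ₁ = τ₁} {κ₂ = κ₂} hσ hτ M =
    trans (ren∘subs (exts-IsRen hσ) (extsˢ-IsNil hτ) M)
      (subs-cong (λ { zero → refl ; (suc x) → ↑ⁱ-comm-ren {κ = κ₂} hσ hτ (σ₁ x) }) (λ _ → refl)
                 (λ b → map-comm (↑ⁱₑ-comm-ren {κ = κ₂} hσ hτ) (τ₁ b)) M)

↑ⁱ-comm : ∀ {σ κ τ} M → subs (exts σ) κ (extsˢ τ) (↑ⁱ M) ≡ ↑ⁱ (subs σ κ τ M)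
↑ⁱ-comm {σ} {κ} {τ} M =
  trans (subs-↑ⁱ M)
  (trans (subs-cong (λ y → ↑ⁱ-as-subs (σ y)) (λ _ → refl) (λ b → map-cong ↑ⁱₑ-as-subsE (τ b)) M)
  (trans (sym (ren∘subs (λ _ → refl) (λ _ → refl) M)) (sym (↑ⁱ-as-subs _))))

↑ⁱₑ-comm : ∀ {σ κ τ} e → subsE (exts σ) κ (extsˢ τ) (↑ⁱₑ e) ≡ ↑ⁱₑ (subsE σ κ τ e)
↑ⁱₑ-comm {σ} {κ} {τ} e =
  trans (subsE-↑ⁱₑ e)
  (trans (subsE-cong (λ y → ↑ⁱ-as-subs (σ y)) (λ _ → refl) (λ b → map-cong ↑ⁱₑ-as-subsE (τ b)) e)
  (trans (sym (ren∘subsE (λ _ → refl) (λ _ → refl) e)) (sym (↑ⁱₑ-as-subsE _))))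

↑ᶜ-comm : ∀ {σ κ τ} M → subs (extsᶜ σ) (lift κ) (extsᶜˢ τ) (↑ᶜ M) ≡ ↑ᶜ (subs σ κ τ M)
↑ᶜ-comm {σ} {κ} {τ} M =
  trans (subs-↑ᶜ M)
  (trans (subs-cong (λ y → ↑ᶜ-as-subs (σ y)) (λ _ → refl) (λ b → map-cong ↑ᶜₑ-as-subsE (τ b)) M)
  (trans (sym (ren∘subs (λ _ → refl) (λ _ → refl) M)) (sym (↑ᶜ-as-subs _))))

↑ᶜₑ-comm : ∀ {σ κ τ} e → subsE (extsᶜ σ) (lift κ) (extsᶜˢ τ) (↑ᶜₑ e) ≡ ↑ᶜₑ (subsE σ κ τ e)
↑ᶜₑ-comm {σ} {κ} {τ} e =
  trans (subsE-↑ᶜₑ e)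
  (trans (subsE-cong (λ y → ↑ᶜ-as-subs (σ y)) (λ _ → refl) (λ b → map-cong ↑ᶜₑ-as-subsE (τ b)) e)
  (trans (sym (ren∘subsE (λ _ → refl) (λ _ → refl) e)) (sym (↑ᶜₑ-as-subsE _))))

-- Under a composite substitution, (a P) first receives the (substituted)
-- stack of the inner substitution, then that of the outer one.
composeˢ : Subst → (ℕ → ℕ) → StackSubst → (ℕ → ℕ) → StackSubst → StackSubst
composeˢ σ₂ κ₂ τ₂ κ₁ τ₁ b = map (subsE σ₂ κ₂ τ₂) (τ₁ b) ++ τ₂ (κ₁ b)

composeˢ-extsˢ : ∀ σ₂ κ₂ τ₂ κ₁ τ₁ →
  composeˢ (exts σ₂) κ₂ (extsˢ τ₂) κ₁ (extsˢ τ₁) ≗ extsˢ (composeˢ σ₂ κ₂ τ₂ κ₁ τ₁)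
composeˢ-extsˢ σ₂ κ₂ τ₂ κ₁ τ₁ b =
  trans (cong (_++ _) (map-comm ↑ⁱₑ-comm (τ₁ b))) (sym (map-++ ↑ⁱₑ (map (subsE σ₂ κ₂ τ₂) (τ₁ b)) _))

composeˢ-extsᶜˢ : ∀ σ₂ κ₂ τ₂ κ₁ τ₁ →
  composeˢ (extsᶜ σ₂) (lift κ₂) (extsᶜˢ τ₂) (lift κ₁) (extsᶜˢ τ₁) ≗ extsᶜˢ (composeˢ σ₂ κ₂ τ₂ κ₁ τ₁)
composeˢ-extsᶜˢ σ₂ κ₂ τ₂ κ₁ τ₁ zero    = refl
composeˢ-extsᶜˢ σ₂ κ₂ τ₂ κ₁ τ₁ (suc b) =
  trans (cong (_++ _) (map-comm ↑ᶜₑ-comm (τ₁ b))) (sym (map-++ ↑ᶜₑ (map (subsE σ₂ κ₂ τ₂) (τ₁ b)) _))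

mutual
  subs∘subs : ∀ {σ₁ κ₁ τ₁ σ₂ κ₂ τ₂} M → subs σ₂ κ₂ τ₂ (subs σ₁ κ₁ τ₁ M)
              ≡ subs (subs σ₂ κ₂ τ₂ ∘ σ₁) (κ₂ ∘ κ₁) (composeˢ σ₂ κ₂ τ₂ κ₁ τ₁) M
  subs∘subs (var x)    = refl
  subs∘subs (lam M)    = cong lam (subs∘subs-exts M)
  subs∘subs (app M e)  = cong₂ app (subs∘subs M) (subsE∘subsE e)
  subs∘subs (pair M N) = cong₂ pair (subs∘subs M) (subs∘subs N)
  subs∘subs (inj₁ M)   = cong inj₁ (subs∘subs M)
  subs∘subs (inj₂ M)   = cong inj₂ (subs∘subs M)
  subs∘subs {σ₁} {κ₁} {τ₁} {σ₂} {κ₂} {τ₂} (mu M) =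
    cong mu (trans (subs∘subs M)
      (subs-cong (λ x → ↑ᶜ-comm (σ₁ x)) (lift-∘ κ₂ κ₁) (composeˢ-extsᶜˢ σ₂ κ₂ τ₂ κ₁ τ₁) M))
  subs∘subs {σ₁} {κ₁} {τ₁} {σ₂} {κ₂} {τ₂} (cvar a M) =
    cong (cvar (κ₂ (κ₁ a)))
      (trans (cong (_· τ₂ (κ₁ a)) (subs-· (subs σ₁ κ₁ τ₁ M) (τ₁ a)))
      (trans (sym (foldl-++ app _ (map (subsE σ₂ κ₂ τ₂) (τ₁ a)) (τ₂ (κ₁ a))))
             (cong (_· composeˢ σ₂ κ₂ τ₂ κ₁ τ₁ a) (subs∘subs M))))

  subsE∘subsE : ∀ {σ₁ κ₁ τ₁ σ₂ κ₂ τ₂} e → subsE σ₂ κ₂ τ₂ (subsE σ₁ κ₁ τ₁ e)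
                ≡ subsE (subs σ₂ κ₂ τ₂ ∘ σ₁) (κ₂ ∘ κ₁) (composeˢ σ₂ κ₂ τ₂ κ₁ τ₁) e
  subsE∘subsE (arg N)      = cong arg (subs∘subs N)
  subsE∘subsE π₁           = refl
  subsE∘subsE π₂           = refl
  subsE∘subsE (case N₁ N₂) = cong₂ case (subs∘subs-exts N₁) (subs∘subs-exts N₂)

  subs∘subs-exts : ∀ {σ₁ κ₁ τ₁ σ₂ κ₂ τ₂} M →
    subs (exts σ₂) κ₂ (extsˢ τ₂) (subs (exts σ₁) κ₁ (extsˢ τ₁) M)
    ≡ subs (exts (subs σ₂ κ₂ τ₂ ∘ σ₁)) (κ₂ ∘ κ₁) (extsˢ (composeˢ σ₂ κ₂ τ₂ κ₁ τ₁)) M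
  subs∘subs-exts {σ₁} {κ₁} {τ₁} {σ₂} {κ₂} {τ₂} M =
    trans (subs∘subs M)
      (subs-cong (λ { zero → refl ; (suc x) → ↑ⁱ-comm (σ₁ x) }) (λ _ → refl) (composeˢ-extsˢ σ₂ κ₂ τ₂ κ₁ τ₁) M)

infixr 6 _∷σ_
_∷σ_ : Term → Subst → Subst
(N ∷σ σ) zero    = N
(N ∷σ σ) (suc x) = σ x

stack₀ : Stack → StackSubst
stack₀ s zero    = s
stack₀ s (suc b) = []

map-cancel : ∀ {f g : Elim → Elim} → (∀ e → f (g e) ≡ e) → ∀ s → map f (map g s) ≡ s
map-cancel p s = trans (map-fuse p s) (map-id s)

[0:=]-as-subs : ∀ M N → M [0:= N ] ≡ subs (N ∷σ var) id nilˢ M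
[0:=]-as-subs M N = sub-as-subs (λ { zero → refl ; (suc x) → refl }) (λ _ → refl) (λ _ → refl) M

subs-∷σ-↑ⁱ : ∀ {N} M → subs (N ∷σ var) id nilˢ (↑ⁱ M) ≡ M
subs-∷σ-↑ⁱ M = trans (subs-↑ⁱ M) (subs-var M)

subsE-∷σ-↑ⁱₑ : ∀ {N} e → subsE (N ∷σ var) id nilˢ (↑ⁱₑ e) ≡ e
subsE-∷σ-↑ⁱₑ e = trans (subsE-↑ⁱₑ e) (subsE-id (λ _ → refl) (λ _ → refl) (λ _ → refl) e)

subs-exts-[0:=] : ∀ {σ κ τ N} M → (subs (exts σ) κ (extsˢ τ) M) [0:= N ] ≡ subs (N ∷σ σ) κ τ M
subs-exts-[0:=] {σ} {κ} {τ} {N} M =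
  trans ([0:=]-as-subs (subs (exts σ) κ (extsˢ τ) M) N)
  (trans (subs∘subs M)
         (subs-cong (λ { zero → refl ; (suc x) → subs-∷σ-↑ⁱ (σ x) }) (λ _ → refl)
                    (λ b → trans (++-identityʳ _) (map-cancel subsE-∷σ-↑ⁱₑ (τ b))) M))

subs-[0:=] : ∀ {σ κ τ} M N →
             (subs (exts σ) κ (extsˢ τ) M) [0:= subs σ κ τ N ] ≡ subs σ κ τ (M [0:= N ])
subs-[0:=] {σ} {κ} {τ} M N =
  trans (subs-exts-[0:=] M)
  (sym (trans (cong (subs σ κ τ) ([0:=]-as-subs M N))
       (trans (subs∘subs M) (subs-cong (λ { zero → refl ; (suc x) → refl }) (λ _ → refl) (λ _ → refl) M))))

only : ℕ → Elim → StackSubst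
only a e b = if b ≡ᵇ a then e ∷ [] else []

map-only : ∀ (f : Elim → Elim) a e b → map f (only a e b) ≡ only a (f e) b
map-only f a e b with b ≡ᵇ a
... | true  = refl
... | false = refl

sstr-cvar : ∀ (c : Bool) b X e →
            (if c then cvar b (app X e) else cvar b X) ≡ cvar b (X · (if c then e ∷ [] else []))
sstr-cvar true  b X e = refl
sstr-cvar false b X e = refl

mutual
  sstr-as-subs : ∀ {a e σ κ τ} → IsRen σ id → κ ≗ id → τ ≗ only a e → ∀ M → sstr a e M ≡ subs σ κ τ M
  sstr-as-subs hσ hκ hτ (var x)    = sym (hσ x)
  sstr-as-subs hσ hκ hτ (lam M)    = cong lam (sstr-as-subs-exts hσ hκ hτ M)
  sstr-as-subs hσ hκ hτ (app M e)  = cong₂ app (sstr-as-subs hσ hκ hτ M) (sstrE-as-subsE hσ hκ hτ e)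
  sstr-as-subs hσ hκ hτ (pair M N) = cong₂ pair (sstr-as-subs hσ hκ hτ M) (sstr-as-subs hσ hκ hτ N)
  sstr-as-subs hσ hκ hτ (inj₁ M)   = cong inj₁ (sstr-as-subs hσ hκ hτ M)
  sstr-as-subs hσ hκ hτ (inj₂ M)   = cong inj₂ (sstr-as-subs hσ hκ hτ M)
  sstr-as-subs {a} {e} hσ hκ hτ (mu M) =
    cong mu (sstr-as-subs (extsᶜ-IsRen hσ) (lift-id hκ)
              (λ { zero → refl ; (suc b) → trans (cong (map ↑ᶜₑ) (hτ b)) (map-only ↑ᶜₑ a e b) }) M)
  sstr-as-subs {a} {e} hσ hκ hτ (cvar b M) =
    trans (sstr-cvar (b ≡ᵇ a) b (sstr a e M) e)
          (cong₂ cvar (sym (hκ b)) (cong₂ _·_ (sstr-as-subs hσ hκ hτ M) (sym (hτ b))))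

  sstrE-as-subsE : ∀ {a e σ κ τ} → IsRen σ id → κ ≗ id → τ ≗ only a e → ∀ e' → sstrE a e e' ≡ subsE σ κ τ e'
  sstrE-as-subsE hσ hκ hτ (arg N)      = cong arg (sstr-as-subs hσ hκ hτ N)
  sstrE-as-subsE hσ hκ hτ π₁           = refl
  sstrE-as-subsE hσ hκ hτ π₂           = refl
  sstrE-as-subsE hσ hκ hτ (case N₁ N₂) = cong₂ case (sstr-as-subs-exts hσ hκ hτ N₁) (sstr-as-subs-exts hσ hκ hτ N₂)

  sstr-as-subs-exts : ∀ {a e σ κ τ} → IsRen σ id → κ ≗ id → τ ≗ only a e →
                      ∀ M → sstr a (↑ⁱₑ e) M ≡ subs (exts σ) κ (extsˢ τ) M
  sstr-as-subs-exts {a} {e} hσ hκ hτ =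
    sstr-as-subs (exts-IsRen-id hσ) hκ (λ b → trans (cong (map ↑ⁱₑ) (hτ b)) (map-only ↑ⁱₑ a e b))

sstr₀-as-subs : ∀ e M → sstr zero e M ≡ subs var id (stack₀ (e ∷ [])) M
sstr₀-as-subs e = sstr-as-subs (λ _ → refl) (λ _ → refl) (λ { zero → refl ; (suc b) → refl })

subs-stack₀-↑ᶜ : ∀ {s} M → subs var id (stack₀ s) (↑ᶜ M) ≡ ↑ᶜ M
subs-stack₀-↑ᶜ M = trans (subs-↑ᶜ M) (sym (↑ᶜ-as-subs M))

subsE-stack₀-↑ᶜₑ : ∀ {s} e → subsE var id (stack₀ s) (↑ᶜₑ e) ≡ ↑ᶜₑ e
subsE-stack₀-↑ᶜₑ e = trans (subsE-↑ᶜₑ e) (sym (↑ᶜₑ-as-subsE e))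

subs-sstr₀ : ∀ {σ κ τ} M e →
  sstr zero (↑ᶜₑ (subsE σ κ τ e)) (subs (extsᶜ σ) (lift κ) (extsᶜˢ τ) M)
  ≡ subs (extsᶜ σ) (lift κ) (extsᶜˢ τ) (sstr zero (↑ᶜₑ e) M)
subs-sstr₀ {σ} {κ} {τ} M e =
  trans (sstr₀-as-subs (↑ᶜₑ (subsE σ κ τ e)) (subs (extsᶜ σ) (lift κ) (extsᶜˢ τ) M))
  (trans (subs∘subs M)
  (trans (subs-cong (λ x → subs-stack₀-↑ᶜ (σ x)) (λ _ → refl)
           (λ { zero → cong (_∷ []) (sym (↑ᶜₑ-comm e))
              ; (suc b) → trans (++-identityʳ _) (map-fuse subsE-stack₀-↑ᶜₑ (τ b)) }) M)
  (sym (trans (cong (subs (extsᶜ σ) (lift κ) (extsᶜˢ τ)) (sstr₀-as-subs (↑ᶜₑ e) M))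
              (subs∘subs M)))))

infix 4 _▷*_ _▷ˢ_ _▷ˢ*_

_▷*_ : Term → Term → Set
_▷*_ = Star _▷_

data _▷ˢ_ : Stack → Stack → Set where
  here  : ∀ {e e' s} → e ▷ₑ e' → (e ∷ s) ▷ˢ (e' ∷ s)
  there : ∀ {e s s'} → s ▷ˢ s' → (e ∷ s) ▷ˢ (e ∷ s')
  commˢ : ∀ {N₁ N₂ e s} → (case N₁ N₂ ∷ e ∷ s) ▷ˢ (case (app N₁ (↑ⁱₑ e)) (app N₂ (↑ⁱₑ e)) ∷ s)

_▷ˢ*_ : Stack → Stack → Set
_▷ˢ*_ = Star _▷ˢ_

·-congˡ : ∀ {M M'} s → M ▷ M' → M · s ▷ M' · s
·-congˡ []      h = h
·-congˡ (e ∷ s) h = ·-congˡ s (appˡ h)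

·-congʳ : ∀ {M s s'} → s ▷ˢ s' → M · s ▷ M · s'
·-congʳ {s = e ∷ s}             (here h)  = ·-congˡ s (appʳ h)
·-congʳ                         (there h) = ·-congʳ h
·-congʳ {s = case _ _ ∷ _ ∷ s} commˢ     = ·-congˡ s comm

mutual
  subs-▷ : ∀ {σ κ τ M M'} → M ▷ M' → subs σ κ τ M ▷ subs σ κ τ M'
  subs-▷ (β {M} {N})          = subst (app (lam _) (arg _) ▷_) (subs-[0:=] M N) β
  subs-▷ π₁β                  = π₁β
  subs-▷ π₂β                  = π₂β
  subs-▷ (ω₁β {M} {N₁})       = subst (app (inj₁ _) _ ▷_) (subs-[0:=] N₁ M) ω₁β
  subs-▷ (ω₂β {M} {N₂ = N₂})  = subst (app (inj₂ _) _ ▷_) (subs-[0:=] N₂ M) ω₂β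
  subs-▷ {σ} {κ} {τ} (comm {M} {N₁} {N₂} {e}) =
    subst (λ z → subs σ κ τ (app (app M (case N₁ N₂)) e) ▷
                 app (subs σ κ τ M) (case (app (subs (exts σ) κ (extsˢ τ) N₁) z)
                                          (app (subs (exts σ) κ (extsˢ τ) N₂) z)))
          (sym (↑ⁱₑ-comm e)) comm
  subs-▷ (μβ {M} {e})         = subst (λ z → app (mu _) _ ▷ mu z) (subs-sstr₀ M e) μβ
  subs-▷ (lam-c h)            = lam-c (subs-▷ h)
  subs-▷ (appˡ h)             = appˡ (subs-▷ h)
  subs-▷ (appʳ h)             = appʳ (subsE-▷ h)
  subs-▷ (pairˡ h)            = pairˡ (subs-▷ h)
  subs-▷ (pairʳ h)            = pairʳ (subs-▷ h)
  subs-▷ (inj₁-c h)           = inj₁-c (subs-▷ h)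
  subs-▷ (inj₂-c h)           = inj₂-c (subs-▷ h)
  subs-▷ (mu-c h)             = mu-c (subs-▷ h)
  subs-▷ {τ = τ} (cvar-c {a} h) = cvar-c (·-congˡ (τ a) (subs-▷ h))

  subsE-▷ : ∀ {σ κ τ e e'} → e ▷ₑ e' → subsE σ κ τ e ▷ₑ subsE σ κ τ e'
  subsE-▷ (arg-c h) = arg-c (subs-▷ h)
  subsE-▷ (caseˡ h) = caseˡ (subs-▷ h)
  subsE-▷ (caseʳ h) = caseʳ (subs-▷ h)

map-subsE-▷ˢ : ∀ {σ κ τ s s'} → s ▷ˢ s' → map (subsE σ κ τ) s ▷ˢ map (subsE σ κ τ) s'
map-subsE-▷ˢ (here h)  = here (subsE-▷ h)
map-subsE-▷ˢ (there h) = there (map-subsE-▷ˢ h)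
map-subsE-▷ˢ {σ} {κ} {τ} (commˢ {N₁} {N₂} {e} {s}) =
  subst (λ z → map (subsE σ κ τ) (case N₁ N₂ ∷ e ∷ s) ▷ˢ
               case (app (subs (exts σ) κ (extsˢ τ) N₁) z) (app (subs (exts σ) κ (extsˢ τ) N₂) z)
               ∷ map (subsE σ κ τ) s)
        (sym (↑ⁱₑ-comm e)) commˢ

↑ⁱ-▷ : ∀ {M M'} → M ▷ M' → ↑ⁱ M ▷ ↑ⁱ M'
↑ⁱ-▷ {M} {M'} h = subst₂ _▷_ (sym (↑ⁱ-as-subs M)) (sym (↑ⁱ-as-subs M')) (subs-▷ h)

↑ᶜ-▷ : ∀ {M M'} → M ▷ M' → ↑ᶜ M ▷ ↑ᶜ M'
↑ᶜ-▷ {M} {M'} h = subst₂ _▷_ (sym (↑ᶜ-as-subs M)) (sym (↑ᶜ-as-subs M')) (subs-▷ h)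

↑ⁱ-▷ˢ : ∀ {s s'} → s ▷ˢ s' → map ↑ⁱₑ s ▷ˢ map ↑ⁱₑ s'
↑ⁱ-▷ˢ {s} {s'} h =
  subst₂ _▷ˢ_ (sym (map-cong ↑ⁱₑ-as-subsE s)) (sym (map-cong ↑ⁱₑ-as-subsE s')) (map-subsE-▷ˢ h)

↑ᶜ-▷ˢ : ∀ {s s'} → s ▷ˢ s' → map ↑ᶜₑ s ▷ˢ map ↑ᶜₑ s'
↑ᶜ-▷ˢ {s} {s'} h =
  subst₂ _▷ˢ_ (sym (map-cong ↑ᶜₑ-as-subsE s)) (sym (map-cong ↑ᶜₑ-as-subsE s')) (map-subsE-▷ˢ h)

[0:=]-▷ : ∀ {M M' N} → M ▷ M' → M [0:= N ] ▷ M' [0:= N ]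
[0:=]-▷ {M} {M'} {N} h = subst₂ _▷_ (sym ([0:=]-as-subs M N)) (sym ([0:=]-as-subs M' N)) (subs-▷ h)

exts-▷* : ∀ {σ σ'} → (∀ x → σ x ▷* σ' x) → ∀ x → exts σ x ▷* exts σ' x
exts-▷* h zero    = ε
exts-▷* h (suc x) = gmap ↑ⁱ ↑ⁱ-▷ (h x)

extsᶜ-▷* : ∀ {σ σ'} → (∀ x → σ x ▷* σ' x) → ∀ x → extsᶜ σ x ▷* extsᶜ σ' x
extsᶜ-▷* h x = gmap ↑ᶜ ↑ᶜ-▷ (h x)

extsˢ-▷ˢ* : ∀ {τ τ'} → (∀ b → τ b ▷ˢ* τ' b) → ∀ b → extsˢ τ b ▷ˢ* extsˢ τ' b
extsˢ-▷ˢ* h b = gmap (map ↑ⁱₑ) ↑ⁱ-▷ˢ (h b)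

extsᶜˢ-▷ˢ* : ∀ {τ τ'} → (∀ b → τ b ▷ˢ* τ' b) → ∀ b → extsᶜˢ τ b ▷ˢ* extsᶜˢ τ' b
extsᶜˢ-▷ˢ* h zero    = ε
extsᶜˢ-▷ˢ* h (suc b) = gmap (map ↑ᶜₑ) ↑ᶜ-▷ˢ (h b)

mutual
  subs-▷* : ∀ {σ σ' κ τ τ'} → (∀ x → σ x ▷* σ' x) → (∀ b → τ b ▷ˢ* τ' b) →
            ∀ M → subs σ κ τ M ▷* subs σ' κ τ' M
  subs-▷* hσ hτ (var x)    = hσ x
  subs-▷* hσ hτ (lam M)    = gmap lam lam-c (subs-▷* (exts-▷* hσ) (extsˢ-▷ˢ* hτ) M)
  subs-▷* hσ hτ (app M e)  = gmap (λ z → app z _) appˡ (subs-▷* hσ hτ M) ◅◅ gmap (app _) appʳ (subsE-▷* hσ hτ e)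
  subs-▷* hσ hτ (pair M N) = gmap (λ z → pair z _) pairˡ (subs-▷* hσ hτ M) ◅◅ gmap (pair _) pairʳ (subs-▷* hσ hτ N)
  subs-▷* hσ hτ (inj₁ M)   = gmap inj₁ inj₁-c (subs-▷* hσ hτ M)
  subs-▷* hσ hτ (inj₂ M)   = gmap inj₂ inj₂-c (subs-▷* hσ hτ M)
  subs-▷* hσ hτ (mu M)     = gmap mu mu-c (subs-▷* (extsᶜ-▷* hσ) (extsᶜˢ-▷ˢ* hτ) M)
  subs-▷* {τ = τ} hσ hτ (cvar a M) =
    gmap (cvar _) cvar-c (gmap (_· τ a) (·-congˡ (τ a)) (subs-▷* hσ hτ M) ◅◅ gmap (_ ·_) ·-congʳ (hτ a))

  subsE-▷* : ∀ {σ σ' κ τ τ'} → (∀ x → σ x ▷* σ' x) → (∀ b → τ b ▷ˢ* τ' b) →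
             ∀ e → Star _▷ₑ_ (subsE σ κ τ e) (subsE σ' κ τ' e)
  subsE-▷* hσ hτ (arg N)      = gmap arg arg-c (subs-▷* hσ hτ N)
  subsE-▷* hσ hτ π₁           = ε
  subsE-▷* hσ hτ π₂           = ε
  subsE-▷* hσ hτ (case N₁ N₂) =
    gmap (λ z → case z _) caseˡ (subs-▷* (exts-▷* hσ) (extsˢ-▷ˢ* hτ) N₁)
    ◅◅ gmap (case _) caseʳ (subs-▷* (exts-▷* hσ) (extsˢ-▷ˢ* hτ) N₂)

SN-▷* : ∀ {M N} → SN M → M ▷* N → SN N
SN-▷* snM       ε        = snM
SN-▷* (sn next) (h ◅ hs) = SN-▷* (next h) hs

SN-appˡ : ∀ {M e} → SN (app M e) → SN M
SN-appˡ (sn next) = sn (λ h → SN-appˡ (next (appˡ h)))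

SN-·ˡ : ∀ M s → SN (M · s) → SN M
SN-·ˡ M []      snM = snM
SN-·ˡ M (e ∷ s) snM = SN-appˡ (SN-·ˡ (app M e) s snM)

SN-subs⁻¹ : ∀ {σ κ τ} M → SN (subs σ κ τ M) → SN M
SN-subs⁻¹ M (sn next) = sn (λ {M'} h → SN-subs⁻¹ M' (next (subs-▷ h)))

SN-[0:=]⁻¹ : ∀ {N} M → SN (M [0:= N ]) → SN M
SN-[0:=]⁻¹ {N} M snM = SN-subs⁻¹ M (subst SN ([0:=]-as-subs M N) snM)

SN-cvar : ∀ {a M} → SN M → SN (cvar a M)
SN-cvar (sn next) = sn (λ { (cvar-c h) → SN-cvar (next h) })

data SNˢ (s : Stack) : Set where
  snˢ : (∀ {s'} → s ▷ˢ s' → SNˢ s') → SNˢ s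

SNˢ-tail : ∀ {e s} → SNˢ (e ∷ s) → SNˢ s
SNˢ-tail (snˢ next) = snˢ (λ h → SNˢ-tail (next (there h)))

data ·-Step (M : Term) : Stack → Term → Set where
  term-step  : ∀ {N} → M ▷ N → ·-Step M [] N
  stack-step : ∀ {s s'} → s ▷ˢ s' → ·-Step M s (M · s')
  head-step  : ∀ {e r X} → app M e ▷ X → ·-Step M (e ∷ r) (X · r)

·-step-inv : ∀ M s {N} → M · s ▷ N → ·-Step M s N
·-step-inv M []      h = term-step h
·-step-inv M (e ∷ s) h with ·-step-inv (app M e) s h
... | term-step h'          = head-step h'
... | stack-step h'         = stack-step (there h')
... | head-step comm        = stack-step commˢ
... | head-step (appˡ h')   = head-step h'
... | head-step (appʳ h')   = stack-step (there (here h'))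

mutual
  SN-var· : ∀ {x} s → SNˢ s → SN (var x · s)
  SN-var· s sns = sn (λ h → SN-var·-step sns (·-step-inv _ s h))

  SN-var·-step : ∀ {x s N} → SNˢ s → ·-Step (var x) s N → SN N
  SN-var·-step _           (term-step ())
  SN-var·-step (snˢ next) (stack-step h)      = SN-var· _ (next h)
  SN-var·-step (snˢ next) (head-step (appʳ h)) = SN-var· _ (next (here h))
  SN-var·-step _           (head-step (appˡ ()))

-- Commuting conversions move the rest of the stack into the branches of a
-- case, so the branches must be SN together with it.
SNComponents : Stack → Set
SNComponents []               = ⊤
SNComponents (arg N ∷ s)      = SN N × SNComponents s
SNComponents (π₁ ∷ s)         = SNComponents s
SNComponents (π₂ ∷ s)         = SNComponents s
SNComponents (case N₁ N₂ ∷ s) = SN (N₁ · map ↑ⁱₑ s) × SN (N₂ · map ↑ⁱₑ s)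

SNˢ-arg : ∀ {N s} → SN N → SNˢ s → SNˢ (arg N ∷ s)
SNˢ-arg snN@(sn nextN) sns@(snˢ nexts) =
  snˢ λ { (here (arg-c h)) → SNˢ-arg (nextN h) sns ; (there h) → SNˢ-arg snN (nexts h) }

SNˢ-π₁ : ∀ {s} → SNˢ s → SNˢ (π₁ ∷ s)
SNˢ-π₁ (snˢ next) = snˢ λ { (here ()) ; (there h) → SNˢ-π₁ (next h) }

SNˢ-π₂ : ∀ {s} → SNˢ s → SNˢ (π₂ ∷ s)
SNˢ-π₂ (snˢ next) = snˢ λ { (here ()) ; (there h) → SNˢ-π₂ (next h) }

mutual
  SNˢ-case : ∀ {N₁ N₂} s → SN (N₁ · map ↑ⁱₑ s) → SN (N₂ · map ↑ⁱₑ s) → SNˢ (case N₁ N₂ ∷ s)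
  SNˢ-case s sn₁ sn₂ = snˢ (SNˢ-case-step s sn₁ sn₂)

  SNˢ-case-step : ∀ {N₁ N₂} s → SN (N₁ · map ↑ⁱₑ s) → SN (N₂ · map ↑ⁱₑ s) →
                  ∀ {s'} → case N₁ N₂ ∷ s ▷ˢ s' → SNˢ s'
  SNˢ-case-step s (sn next₁) sn₂ (here (caseˡ h)) = SNˢ-case s (next₁ (·-congˡ (map ↑ⁱₑ s) h)) sn₂
  SNˢ-case-step s sn₁ (sn next₂) (here (caseʳ h)) = SNˢ-case s sn₁ (next₂ (·-congˡ (map ↑ⁱₑ s) h))
  SNˢ-case-step s (sn next₁) (sn next₂) (there h) =
    SNˢ-case _ (next₁ (·-congʳ (↑ⁱ-▷ˢ h))) (next₂ (·-congʳ (↑ⁱ-▷ˢ h)))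
  SNˢ-case-step (e ∷ r) sn₁ sn₂ commˢ = SNˢ-case r sn₁ sn₂

SNˢ-components : ∀ s → SNComponents s → SNˢ s
SNˢ-components []               _           = snˢ (λ ())
SNˢ-components (arg N ∷ s)      (snN , sns) = SNˢ-arg snN (SNˢ-components s sns)
SNˢ-components (π₁ ∷ s)         sns         = SNˢ-π₁ (SNˢ-components s sns)
SNˢ-components (π₂ ∷ s)         sns         = SNˢ-π₂ (SNˢ-components s sns)
SNˢ-components (case N₁ N₂ ∷ s) (sn₁ , sn₂) = SNˢ-case s sn₁ sn₂

[0:=]-▷* : ∀ {N N'} M → N ▷ N' → M [0:= N ] ▷* M [0:= N' ]
[0:=]-▷* {N} {N'} M h =
  subst₂ _▷*_ (sym ([0:=]-as-subs M N)) (sym ([0:=]-as-subs M N'))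
    (subs-▷* (λ { zero → h ◅ ε ; (suc x) → ε }) (λ _ → ε) M)

·-congˡ* : ∀ {M M'} s → M ▷* M' → M · s ▷* M' · s
·-congˡ* s = gmap (_· s) (·-congˡ s)

[0:=]-· : ∀ M s N → (M · map ↑ⁱₑ s) [0:= N ] ≡ M [0:= N ] · s
[0:=]-· M s N =
  trans ([0:=]-as-subs (M · map ↑ⁱₑ s) N)
  (trans (subs-· M (map ↑ⁱₑ s))
         (cong₂ _·_ (sym ([0:=]-as-subs M N)) (map-cancel subsE-∷σ-↑ⁱₑ s)))

-- Each head expansion lemma is proved by a lexicographic induction on the
-- SN hypotheses, in the order in which they are listed.
mutual
  SN-β-expand : ∀ {M N} s → SN N → SN (M [0:= N ] · s) → SN (lam M · (arg N ∷ s))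
  SN-β-expand s snN snR = sn (λ h → SN-β-expand-step snN snR (·-step-inv _ (arg _ ∷ s) h))

  SN-β-expand-step : ∀ {M N s K} → SN N → SN (M [0:= N ] · s) → ·-Step (lam M) (arg N ∷ s) K → SN K
  SN-β-expand-step {M} {s = s} (sn next) snR (stack-step (here (arg-c h))) =
    SN-β-expand s (next h) (SN-▷* snR (·-congˡ* s ([0:=]-▷* M h)))
  SN-β-expand-step {M} {s = s} (sn next) snR (head-step (appʳ (arg-c h))) =
    SN-β-expand s (next h) (SN-▷* snR (·-congˡ* s ([0:=]-▷* M h)))
  SN-β-expand-step {M} snN (sn next) (stack-step (there {s' = s'} h)) = SN-β-expand {M} s' snN (next (·-congʳ h))
  SN-β-expand-step snN snR (head-step β) = snR
  SN-β-expand-step {s = s} snN (sn next) (head-step (appˡ (lam-c h))) =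
    SN-β-expand s snN (next (·-congˡ s ([0:=]-▷ h)))

mutual
  SN-π₁-expand : ∀ {M₁ M₂} s → SN M₂ → SN (M₁ · s) → SN (pair M₁ M₂ · (π₁ ∷ s))
  SN-π₁-expand s sn₂ snR = sn (λ h → SN-π₁-expand-step sn₂ snR (·-step-inv _ (π₁ ∷ s) h))

  SN-π₁-expand-step : ∀ {M₁ M₂ s K} → SN M₂ → SN (M₁ · s) → ·-Step (pair M₁ M₂) (π₁ ∷ s) K → SN K
  SN-π₁-expand-step sn₂ snR (stack-step (here ()))
  SN-π₁-expand-step {M₁} sn₂ (sn next) (stack-step (there {s' = s'} h)) = SN-π₁-expand {M₁} s' sn₂ (next (·-congʳ h))
  SN-π₁-expand-step sn₂ snR (head-step π₁β) = snR
  SN-π₁-expand-step {s = s} sn₂ (sn next) (head-step (appˡ (pairˡ h))) =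
    SN-π₁-expand s sn₂ (next (·-congˡ s h))
  SN-π₁-expand-step {s = s} (sn next) snR (head-step (appˡ (pairʳ h))) = SN-π₁-expand s (next h) snR
  SN-π₁-expand-step sn₂ snR (head-step (appʳ ()))

mutual
  SN-π₂-expand : ∀ {M₁ M₂} s → SN M₁ → SN (M₂ · s) → SN (pair M₁ M₂ · (π₂ ∷ s))
  SN-π₂-expand s sn₁ snR = sn (λ h → SN-π₂-expand-step sn₁ snR (·-step-inv _ (π₂ ∷ s) h))

  SN-π₂-expand-step : ∀ {M₁ M₂ s K} → SN M₁ → SN (M₂ · s) → ·-Step (pair M₁ M₂) (π₂ ∷ s) K → SN K
  SN-π₂-expand-step sn₁ snR (stack-step (here ()))
  SN-π₂-expand-step {M₂ = M₂} sn₁ (sn next) (stack-step (there {s' = s'} h)) =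
    SN-π₂-expand {M₂ = M₂} s' sn₁ (next (·-congʳ h))
  SN-π₂-expand-step sn₁ snR (head-step π₂β) = snR
  SN-π₂-expand-step {s = s} sn₁ (sn next) (head-step (appˡ (pairʳ h))) =
    SN-π₂-expand s sn₁ (next (·-congˡ s h))
  SN-π₂-expand-step {s = s} (sn next) snR (head-step (appˡ (pairˡ h))) = SN-π₂-expand s (next h) snR
  SN-π₂-expand-step sn₁ snR (head-step (appʳ ()))

mutual
  SN-ω₁-expand : ∀ {M N₁ N₂} s → SN M → SN ((N₁ · map ↑ⁱₑ s) [0:= M ]) → SN (N₂ · map ↑ⁱₑ s) →
                 SN (inj₁ M · (case N₁ N₂ ∷ s))
  SN-ω₁-expand s snM sn₁ sn₂ = sn (λ h → SN-ω₁-expand-step snM sn₁ sn₂ (·-step-inv _ (case _ _ ∷ s) h))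

  SN-ω₁-expand-step : ∀ {M N₁ N₂ s K} → SN M → SN ((N₁ · map ↑ⁱₑ s) [0:= M ]) → SN (N₂ · map ↑ⁱₑ s) →
                      ·-Step (inj₁ M) (case N₁ N₂ ∷ s) K → SN K
  SN-ω₁-expand-step {M} {N₁} {N₂} {s} snM (sn next₁) sn₂ (stack-step (here (caseˡ h))) =
    SN-ω₁-expand {M} {_} {N₂} s snM (next₁ ([0:=]-▷ (·-congˡ (map ↑ⁱₑ s) h))) sn₂
  SN-ω₁-expand-step {M} {N₁} {N₂} {s} snM (sn next₁) sn₂ (head-step (appʳ (caseˡ h))) =
    SN-ω₁-expand {M} {_} {N₂} s snM (next₁ ([0:=]-▷ (·-congˡ (map ↑ⁱₑ s) h))) sn₂
  SN-ω₁-expand-step {s = s} snM sn₁ (sn next₂) (stack-step (here (caseʳ h))) =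
    SN-ω₁-expand s snM sn₁ (next₂ (·-congˡ (map ↑ⁱₑ s) h))
  SN-ω₁-expand-step {s = s} snM sn₁ (sn next₂) (head-step (appʳ (caseʳ h))) =
    SN-ω₁-expand s snM sn₁ (next₂ (·-congˡ (map ↑ⁱₑ s) h))
  SN-ω₁-expand-step {M} {N₁} {N₂} snM (sn next₁) (sn next₂) (stack-step (there {s' = s'} h)) =
    SN-ω₁-expand {M} {N₁} {N₂} s' snM (next₁ ([0:=]-▷ (·-congʳ (↑ⁱ-▷ˢ h)))) (next₂ (·-congʳ (↑ⁱ-▷ˢ h)))
  SN-ω₁-expand-step {s = e ∷ r} snM sn₁ sn₂ (stack-step commˢ) = SN-ω₁-expand r snM sn₁ sn₂
  SN-ω₁-expand-step {M} {N₁} {s = s} snM sn₁ sn₂ (head-step ω₁β) = subst SN ([0:=]-· N₁ s M) sn₁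
  SN-ω₁-expand-step {N₁ = N₁} {s = s} (sn next) sn₁ sn₂ (head-step (appˡ (inj₁-c h))) =
    SN-ω₁-expand s (next h) (SN-▷* sn₁ ([0:=]-▷* (N₁ · map ↑ⁱₑ s) h)) sn₂

mutual
  SN-ω₂-expand : ∀ {M N₁ N₂} s → SN M → SN ((N₂ · map ↑ⁱₑ s) [0:= M ]) → SN (N₁ · map ↑ⁱₑ s) →
                 SN (inj₂ M · (case N₁ N₂ ∷ s))
  SN-ω₂-expand s snM sn₂ sn₁ = sn (λ h → SN-ω₂-expand-step snM sn₂ sn₁ (·-step-inv _ (case _ _ ∷ s) h))

  SN-ω₂-expand-step : ∀ {M N₁ N₂ s K} → SN M → SN ((N₂ · map ↑ⁱₑ s) [0:= M ]) → SN (N₁ · map ↑ⁱₑ s) →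
                      ·-Step (inj₂ M) (case N₁ N₂ ∷ s) K → SN K
  SN-ω₂-expand-step {M} {N₁} {N₂} {s} snM (sn next₂) sn₁ (stack-step (here (caseʳ h))) =
    SN-ω₂-expand {M} {N₁} {_} s snM (next₂ ([0:=]-▷ (·-congˡ (map ↑ⁱₑ s) h))) sn₁
  SN-ω₂-expand-step {M} {N₁} {N₂} {s} snM (sn next₂) sn₁ (head-step (appʳ (caseʳ h))) =
    SN-ω₂-expand {M} {N₁} {_} s snM (next₂ ([0:=]-▷ (·-congˡ (map ↑ⁱₑ s) h))) sn₁
  SN-ω₂-expand-step {s = s} snM sn₂ (sn next₁) (stack-step (here (caseˡ h))) =
    SN-ω₂-expand s snM sn₂ (next₁ (·-congˡ (map ↑ⁱₑ s) h))
  SN-ω₂-expand-step {s = s} snM sn₂ (sn next₁) (head-step (appʳ (caseˡ h))) =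
    SN-ω₂-expand s snM sn₂ (next₁ (·-congˡ (map ↑ⁱₑ s) h))
  SN-ω₂-expand-step {M} {N₁} {N₂} snM (sn next₂) (sn next₁) (stack-step (there {s' = s'} h)) =
    SN-ω₂-expand {M} {N₁} {N₂} s' snM (next₂ ([0:=]-▷ (·-congʳ (↑ⁱ-▷ˢ h)))) (next₁ (·-congʳ (↑ⁱ-▷ˢ h)))
  SN-ω₂-expand-step {s = e ∷ r} snM sn₂ sn₁ (stack-step commˢ) = SN-ω₂-expand r snM sn₂ sn₁
  SN-ω₂-expand-step {M} {N₂ = N₂} {s = s} snM sn₂ sn₁ (head-step ω₂β) = subst SN ([0:=]-· N₂ s M) sn₂
  SN-ω₂-expand-step {N₂ = N₂} {s = s} (sn next) sn₂ sn₁ (head-step (appˡ (inj₂-c h))) =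
    SN-ω₂-expand s (next h) (SN-▷* sn₂ ([0:=]-▷* (N₂ · map ↑ⁱₑ s) h)) sn₁

-- Q with every (0 P) replaced by (0 (P · s)): the body that μ Q reaches
-- after absorbing the whole stack s by μβ steps.
sstr* : Stack → Term → Term
sstr* s Q = subs var id (stack₀ (map ↑ᶜₑ s)) Q

sstr*-∷ : ∀ e r Q → sstr* (e ∷ r) Q ≡ sstr* r (sstr zero (↑ᶜₑ e) Q)
sstr*-∷ e r Q =
  sym (trans (cong (sstr* r) (sstr₀-as-subs (↑ᶜₑ e) Q))
      (trans (subs∘subs Q)
             (subs-cong (λ _ → refl) (λ _ → refl)
                (λ { zero → cong (_∷ map ↑ᶜₑ r) (subsE-stack₀-↑ᶜₑ e) ; (suc b) → refl }) Q)))

sstr*-▷* : ∀ {s s'} Q → s ▷ˢ s' → sstr* s Q ▷* sstr* s' Q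
sstr*-▷* Q h = subs-▷* (λ _ → ε) (λ { zero → ↑ᶜ-▷ˢ h ◅ ε ; (suc b) → ε }) Q

▷ˢ-length : ∀ {s s'} → s ▷ˢ s' → length s' ≤ length s
▷ˢ-length (here h)          = ≤-refl
▷ˢ-length (there h)         = s≤s (▷ˢ-length h)
▷ˢ-length (commˢ {s = s})   = s≤s (n≤1+n (length s))

-- A μβ step shortens the stack without making the stack or the body
-- smaller, hence the additional bound n on the length of the stack.
mutual
  SN-μ-expand : ∀ {Q} s n → length s ≤ n → SNˢ s → SN (sstr* s Q) → SN (mu Q · s)
  SN-μ-expand s n le sns snR = sn (λ h → SN-μ-expand-step n le sns snR (·-step-inv _ s h))

  SN-μ-expand-step : ∀ {Q s K} n → length s ≤ n → SNˢ s → SN (sstr* s Q) → ·-Step (mu Q) s K → SN K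
  SN-μ-expand-step n le sns (sn next) (term-step (mu-c h)) = SN-μ-expand [] n le sns (next (subs-▷ h))
  SN-μ-expand-step {s = s} n le sns (sn next) (head-step (appˡ (mu-c h))) =
    SN-μ-expand s n le sns (next (subs-▷ h))
  SN-μ-expand-step {Q} n le (snˢ next) snR (stack-step {s' = s'} h) =
    SN-μ-expand s' n (≤-trans (▷ˢ-length h) le) (next h) (SN-▷* snR (sstr*-▷* Q h))
  SN-μ-expand-step {Q} {e ∷ r} n le (snˢ next) snR (head-step (appʳ {ε' = e'} h)) =
    SN-μ-expand (e' ∷ r) n le (next (here h)) (SN-▷* snR (sstr*-▷* Q (here h)))
  SN-μ-expand-step {Q} {e ∷ r} (suc n) (s≤s le) sns snR (head-step μβ) =
    SN-μ-expand r n le (SNˢ-tail sns) (subst SN (sstr*-∷ e r Q) snR)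

renᶜ : (ℕ → ℕ) → Term → Term
renᶜ κ = subs var κ nilˢ

renᶜE : (ℕ → ℕ) → Elim → Elim
renᶜE κ = subsE var κ nilˢ

-- A term is reducible of type A when, after any renaming of its classical
-- variables, it is SN in front of every A-stack.  The renamings are needed
-- to cross μ binders.
mutual
  Reducible : Form → Term → Set
  Reducible A M = ∀ κ s → StackOf A s → SN (renᶜ κ M · s)

  StackOf : Form → Stack → Set
  StackOf (atom n)  s                = s ≡ []
  StackOf ⊥ᶠ        s                = s ≡ []
  StackOf (A ⇒ B)   (arg N ∷ s)      = Reducible A N × StackOf B s
  StackOf (A ∧ᶠ B)  (π₁ ∷ s)         = StackOf A s
  StackOf (A ∧ᶠ B)  (π₂ ∷ s)         = StackOf B s
  StackOf (A ∨ᶠ B)  (case N₁ N₂ ∷ s) = Branch A N₁ s × Branch B N₂ s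
  StackOf _         _                = ⊥

  Branch : Form → Term → Stack → Set
  Branch A N s = ∀ κ P → Reducible A P → SN (renᶜ κ (N · map ↑ⁱₑ s) [0:= P ])

-- The stack substituted for a classical variable of type ¬A.
StackOrNil : Form → Stack → Set
StackOrNil A s = StackOf A s ⊎ s ≡ []

renᶜ-renᶜ : ∀ κ κ' M → renᶜ κ' (renᶜ κ M) ≡ renᶜ (κ' ∘ κ) M
renᶜ-renᶜ κ κ' = subs∘ren (λ _ → refl) (λ _ → refl)

renᶜE-renᶜE : ∀ κ κ' e → renᶜE κ' (renᶜE κ e) ≡ renᶜE (κ' ∘ κ) e
renᶜE-renᶜE κ κ' = subsE∘ren (λ _ → refl) (λ _ → refl)

renᶜ-exts : ∀ κ → subs (exts var) κ (extsˢ nilˢ) ≗ renᶜ κ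
renᶜ-exts κ = subs-cong (exts-IsRen-id (λ _ → refl)) (λ _ → refl) (extsˢ-IsNil (λ _ → refl))

renᶜE-↑ⁱₑ : ∀ κ e → renᶜE κ (↑ⁱₑ e) ≡ ↑ⁱₑ (renᶜE κ e)
renᶜE-↑ⁱₑ κ e =
  trans (sym (subsE-cong (exts-IsRen-id (λ _ → refl)) (λ _ → refl) (extsˢ-IsNil (λ _ → refl)) (↑ⁱₑ e)))
        (↑ⁱₑ-comm e)

renᶜ-·↑ⁱ : ∀ κ M s → renᶜ κ (M · map ↑ⁱₑ s) ≡ renᶜ κ M · map ↑ⁱₑ (map (renᶜE κ) s)
renᶜ-·↑ⁱ κ M s = trans (subs-· M (map ↑ⁱₑ s)) (cong (renᶜ κ M ·_) (map-comm (renᶜE-↑ⁱₑ κ) s))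

renᶜ-case : ∀ κ κ' N s →
  renᶜ κ' (subs (exts var) κ (extsˢ nilˢ) N · map ↑ⁱₑ (map (renᶜE κ) s)) ≡ renᶜ (κ' ∘ κ) (N · map ↑ⁱₑ s)
renᶜ-case κ κ' N s =
  trans (renᶜ-·↑ⁱ κ' _ (map (renᶜE κ) s))
  (trans (cong₂ (λ X t → X · map ↑ⁱₑ t)
                (trans (cong (renᶜ κ') (renᶜ-exts κ N)) (renᶜ-renᶜ κ κ' N))
                (map-fuse (renᶜE-renᶜE κ κ') s))
         (sym (renᶜ-·↑ⁱ (κ' ∘ κ) N s)))

Reducible-renᶜ : ∀ {A M} κ → Reducible A M → Reducible A (renᶜ κ M)
Reducible-renᶜ {M = M} κ r κ' s st = subst (λ X → SN (X · s)) (sym (renᶜ-renᶜ κ κ' M)) (r (κ' ∘ κ) s st)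

StackOf-renᶜ : ∀ A s κ → StackOf A s → StackOf A (map (renᶜE κ) s)
StackOf-renᶜ (atom n) [] κ refl = refl
StackOf-renᶜ ⊥ᶠ       [] κ refl = refl
StackOf-renᶜ (A ⇒ B)  (arg N ∷ s)      κ (r , st)   = Reducible-renᶜ {A} {N} κ r , StackOf-renᶜ B s κ st
StackOf-renᶜ (A ∧ᶠ B) (π₁ ∷ s)         κ st         = StackOf-renᶜ A s κ st
StackOf-renᶜ (A ∧ᶠ B) (π₂ ∷ s)         κ st         = StackOf-renᶜ B s κ st
StackOf-renᶜ (A ∨ᶠ B) (case N₁ N₂ ∷ s) κ (b₁ , b₂) = renamed {A} N₁ b₁ , renamed {B} N₂ b₂
  where
  renamed : ∀ {C} N → Branch C N s → Branch C (subs (exts var) κ (extsˢ nilˢ) N) (map (renᶜE κ) s)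
  renamed N b κ' P r = subst (λ X → SN (X [0:= P ])) (sym (renᶜ-case κ κ' N s)) (b (κ' ∘ κ) P r)

StackOrNil-renᶜ : ∀ A s κ → StackOrNil A s → StackOrNil A (map (renᶜE κ) s)
StackOrNil-renᶜ A s κ (left st)    = left (StackOf-renᶜ A s κ st)
StackOrNil-renᶜ A s κ (right refl) = right refl

Branch-SN⁻¹ : ∀ A N s → Branch A N s → Reducible A (var zero) → SN (N · map ↑ⁱₑ s)
Branch-SN⁻¹ A N s b r0 =
  SN-subs⁻¹ (N · map ↑ⁱₑ s) (SN-[0:=]⁻¹ (renᶜ id (N · map ↑ⁱₑ s)) (b id (var zero) r0))

Branch-at : ∀ A N s {P} → Branch A N s → Reducible A P → SN ((N · map ↑ⁱₑ s) [0:= P ])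
Branch-at A N s {P} b r =
  subst (λ X → SN (X [0:= P ])) (subs-var (N · map ↑ⁱₑ s)) (b id P r)

mutual
  Reducible⇒SN : ∀ A {M} → Reducible A M → SN M
  Reducible⇒SN A {M} r with someStack A
  ... | s , st = SN-subs⁻¹ M (SN-·ˡ _ s (r id s st))

  var-Reducible : ∀ A x → Reducible A (var x)
  var-Reducible A x κ s st = SN-var· s (SNˢ-components s (StackOf⇒SNComponents A s st))

  StackOf⇒SNComponents : ∀ A s → StackOf A s → SNComponents s
  StackOf⇒SNComponents (atom n) [] refl = tt
  StackOf⇒SNComponents ⊥ᶠ       [] refl = tt
  StackOf⇒SNComponents (A ⇒ B)  (arg N ∷ s)      (r , st)   = Reducible⇒SN A r , StackOf⇒SNComponents B s st
  StackOf⇒SNComponents (A ∧ᶠ B) (π₁ ∷ s)         st         = StackOf⇒SNComponents A s st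
  StackOf⇒SNComponents (A ∧ᶠ B) (π₂ ∷ s)         st         = StackOf⇒SNComponents B s st
  StackOf⇒SNComponents (A ∨ᶠ B) (case N₁ N₂ ∷ s) (b₁ , b₂) =
    Branch-SN⁻¹ A N₁ s b₁ (var-Reducible A zero) , Branch-SN⁻¹ B N₂ s b₂ (var-Reducible B zero)

  someStack : ∀ A → Σ Stack (StackOf A)
  someStack (atom n) = [] , refl
  someStack ⊥ᶠ       = [] , refl
  someStack (A ⇒ B)  = arg (var zero) ∷ proj₁ (someStack B) , var-Reducible A zero , proj₂ (someStack B)
  someStack (A ∧ᶠ B) = π₁ ∷ proj₁ (someStack A) , proj₂ (someStack A)
  someStack (A ∨ᶠ B) = case (var zero) (var zero) ∷ [] , (λ κ P → Reducible⇒SN A) , (λ κ P → Reducible⇒SN B)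

Reducible-· : ∀ A {M s} → Reducible A M → StackOf A s → SN (M · s)
Reducible-· A {M} {s} r st = subst (λ X → SN (X · s)) (subs-var M) (r id s st)

Reducible-↑ᶜ : ∀ {A M} → Reducible A M → Reducible A (↑ᶜ M)
Reducible-↑ᶜ {A} {M} r = subst (Reducible A) (sym (↑ᶜ-as-subs M)) (Reducible-renᶜ {A} {M} suc r)

StackOf-↑ᶜ : ∀ A s → StackOf A s → StackOf A (map ↑ᶜₑ s)
StackOf-↑ᶜ A s st = subst (StackOf A) (sym (map-cong ↑ᶜₑ-as-subsE s)) (StackOf-renᶜ A s suc st)

StackOrNil-↑ᶜ : ∀ A s → StackOrNil A s → StackOrNil A (map ↑ᶜₑ s)
StackOrNil-↑ᶜ A s st = subst (StackOrNil A) (sym (map-cong ↑ᶜₑ-as-subsE s)) (StackOrNil-renᶜ A s suc st)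

record RedSubst (Γ Δ : Ctx) : Set where
  field
    σ           : Subst
    κ           : ℕ → ℕ
    τ           : StackSubst
    σ-reducible : ∀ x → Reducible (Γ x) (σ x)
    τ-stacks    : ∀ a → StackOrNil (Δ a) (τ a)

infix 8 _⟪_⟫
_⟪_⟫ : ∀ {Γ Δ} → RedSubst Γ Δ → Term → Term
E ⟪ M ⟫ = subs σ κ τ M
  where open RedSubst E

idRedSubst : ∀ {Γ Δ} → RedSubst Γ Δ
idRedSubst {Γ} = record
  { σ = var ; κ = id ; τ = nilˢ
  ; σ-reducible = λ x → var-Reducible (Γ x) x ; τ-stacks = λ _ → right refl }

renameᶜ : ∀ {Γ Δ} → (ℕ → ℕ) → RedSubst Γ Δ → RedSubst Γ Δ
renameᶜ {Γ} {Δ} κ' E = record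
  { σ = renᶜ κ' ∘ σ ; κ = κ' ∘ κ ; τ = map (renᶜE κ') ∘ τ
  ; σ-reducible = λ x → Reducible-renᶜ {Γ x} {σ x} κ' (σ-reducible x)
  ; τ-stacks    = λ a → StackOrNil-renᶜ (Δ a) (τ a) κ' (τ-stacks a) }
  where open RedSubst E

extend : ∀ {Γ Δ A} → RedSubst Γ Δ → (N : Term) → Reducible A N → RedSubst (Γ ,, A) Δ
extend E N r = record
  { σ = N ∷σ σ ; κ = κ ; τ = τ
  ; σ-reducible = λ { zero → r ; (suc x) → σ-reducible x } ; τ-stacks = τ-stacks }
  where open RedSubst E

infixr 6 _∷ᶜˢ_
_∷ᶜˢ_ : Stack → StackSubst → StackSubst
(s ∷ᶜˢ τ) zero    = map ↑ᶜₑ s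
(s ∷ᶜˢ τ) (suc b) = map ↑ᶜₑ (τ b)

extendᶜ : ∀ {Γ Δ A} → RedSubst Γ Δ → (s : Stack) → StackOf A s → RedSubst Γ (Δ ,, A)
extendᶜ {Γ} {Δ} {A} E s st = record
  { σ = extsᶜ σ ; κ = lift κ ; τ = s ∷ᶜˢ τ
  ; σ-reducible = λ x → Reducible-↑ᶜ {Γ x} {σ x} (σ-reducible x)
  ; τ-stacks    = λ { zero → left (StackOf-↑ᶜ A s st) ; (suc b) → StackOrNil-↑ᶜ (Δ b) (τ b) (τ-stacks b) } }
  where open RedSubst E

renᶜ-⟪⟫ : ∀ {Γ Δ} κ' (E : RedSubst Γ Δ) M → renᶜ κ' (E ⟪ M ⟫) ≡ renameᶜ κ' E ⟪ M ⟫
renᶜ-⟪⟫ κ' E = ren∘subs (λ _ → refl) (λ _ → refl)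

renᶜ-branch : ∀ {σ κ τ} κ' P N s →
  renᶜ κ' (subs (exts σ) κ (extsˢ τ) N · map ↑ⁱₑ s) [0:= P ]
  ≡ subs (P ∷σ (renᶜ κ' ∘ σ)) (κ' ∘ κ) (map (renᶜE κ') ∘ τ) N · map (renᶜE κ') s
renᶜ-branch {σ} {κ} {τ} κ' P N s = begin
  renᶜ κ' (N' · map ↑ⁱₑ s) [0:= P ]
    ≡⟨ cong (_[0:= P ]) (renᶜ-·↑ⁱ κ' N' s) ⟩
  (renᶜ κ' N' · map ↑ⁱₑ (map (renᶜE κ') s)) [0:= P ]
    ≡⟨ [0:=]-· (renᶜ κ' N') (map (renᶜE κ') s) P ⟩
  renᶜ κ' N' [0:= P ] · map (renᶜE κ') s
    ≡⟨ cong (λ X → X [0:= P ] · map (renᶜE κ') s) (trans (sym (renᶜ-exts κ' N')) (ren∘subs-exts (λ _ → refl) (λ _ → refl) N)) ⟩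
  subs (exts (renᶜ κ' ∘ σ)) (κ' ∘ κ) (extsˢ (map (renᶜE κ') ∘ τ)) N [0:= P ] · map (renᶜE κ') s
    ≡⟨ cong (_· map (renᶜE κ') s) (subs-exts-[0:=] N) ⟩
  subs (P ∷σ (renᶜ κ' ∘ σ)) (κ' ∘ κ) (map (renᶜE κ') ∘ τ) N · map (renᶜE κ') s ∎
  where
  open ≡-Reasoning
  N' = subs (exts σ) κ (extsˢ τ) N

sstr*-subs : ∀ {σ κ τ} s P → sstr* s (subs (extsᶜ σ) (lift κ) (extsᶜˢ τ) P) ≡ subs (extsᶜ σ) (lift κ) (s ∷ᶜˢ τ) P
sstr*-subs {σ} {κ} {τ} s P =
  trans (subs∘subs P)
        (subs-cong (λ x → subs-stack₀-↑ᶜ (σ x)) (λ _ → refl)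
                   (λ { zero → refl ; (suc b) → trans (++-identityʳ _) (map-fuse subsE-stack₀-↑ᶜₑ (τ b)) }) P)

mutual
  fundamental : ∀ {Γ Δ M B} → Γ ∣ Δ ⊢ M ∶ B → (E : RedSubst Γ Δ) → Reducible B (E ⟪ M ⟫)
  fundamental {M = M} d E κ' s st =
    subst (λ X → SN (X · s)) (sym (renᶜ-⟪⟫ κ' E M)) (fundamental· d (renameᶜ κ' E) s st)

  fundamental· : ∀ {Γ Δ M B} → Γ ∣ Δ ⊢ M ∶ B → (E : RedSubst Γ Δ) → ∀ s → StackOf B s → SN (E ⟪ M ⟫ · s)
  fundamental· {Γ} (⊢var {x = x}) E s st = Reducible-· (Γ x) (RedSubst.σ-reducible E x) st
  fundamental· (⊢pair {B = B} d₁ d₂) E (π₁ ∷ s) st =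
    SN-π₁-expand s (Reducible⇒SN B (fundamental d₂ E)) (fundamental· d₁ E s st)
  fundamental· (⊢pair {A = A} d₁ d₂) E (π₂ ∷ s) st =
    SN-π₂-expand s (Reducible⇒SN A (fundamental d₁ E)) (fundamental· d₂ E s st)
  fundamental· (⊢π₁ d) E s st = fundamental· d E (π₁ ∷ s) st
  fundamental· (⊢π₂ d) E s st = fundamental· d E (π₂ ∷ s) st
  fundamental· (⊢lam {M = M} {A = A} d) E (arg N ∷ s) (r , st) =
    SN-β-expand s (Reducible⇒SN A r)
      (subst (λ X → SN (X · s)) (sym (subs-exts-[0:=] M)) (fundamental· d (extend E N r) s st))
  fundamental· (⊢app d₁ d₂) E s st = fundamental· d₁ E (arg _ ∷ s) (fundamental d₂ E , st)
  fundamental· (⊢inj₁ {A = A} {B} d) E (case N₁ N₂ ∷ s) (b₁ , b₂) =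
    SN-ω₁-expand s (Reducible⇒SN A r) (Branch-at A N₁ s b₁ r) (Branch-SN⁻¹ B N₂ s b₂ (var-Reducible B zero))
    where r = fundamental d E
  fundamental· (⊢inj₂ {A = A} {B} d) E (case N₁ N₂ ∷ s) (b₁ , b₂) =
    SN-ω₂-expand s (Reducible⇒SN B r) (Branch-at B N₂ s b₂ r) (Branch-SN⁻¹ A N₁ s b₁ (var-Reducible A zero))
    where r = fundamental d E
  fundamental· {Γ} {Δ} (⊢case {C = C} d d₁ d₂) E s st = fundamental· d E (_ ∷ s) (branch d₁ , branch d₂)
    where
    open RedSubst E
    branch : ∀ {A N} → (Γ ,, A) ∣ Δ ⊢ N ∶ C → Branch A (subs (exts σ) κ (extsˢ τ) N) s
    branch {N = N} d' κ' P r =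
      subst SN (sym (renᶜ-branch κ' P N s))
        (fundamental· d' (extend (renameᶜ κ' E) P r) (map (renᶜE κ') s) (StackOf-renᶜ C s κ' st))
  fundamental· (⊢mu {M = P} {A = A} d) E s st =
    SN-μ-expand s (length s) ≤-refl (SNˢ-components s (StackOf⇒SNComponents A s st))
      (subst SN (sym (sstr*-subs s P)) (Reducible⇒SN ⊥ᶠ (fundamental d (extendᶜ E s st))))
  fundamental· {Δ = Δ} (⊢cvar {a = a} d) E [] refl with RedSubst.τ E a | RedSubst.τ-stacks E a
  ... | s   | left st    = SN-cvar (fundamental· d E s st)
  ... | .[] | right refl = SN-cvar (Reducible⇒SN (Δ a) (fundamental d E))

Typed⇒Reducible : ∀ {Γ Δ N A} → Γ ∣ Δ ⊢ N ∶ A → Reducible A N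
Typed⇒Reducible {N = N} {A} d = subst (Reducible A) (subs-var N) (fundamental d idRedSubst)

theorem4p3 : ∀ {Γ Δ B} (M : Term) → Γ ∣ Δ ⊢ M ∶ B → SN M →
    (A : Form) (σ : PSubst) → FiniteDom σ →
    (∀ (x : ℕ) N → σ x ≡ just N → Γ x ≡ A × TypedAs N A × SN N) →
    SN (M [ σ ])
theorem4p3 {Γ} {Δ} {B} M ⊢M _ A σ _ hyp =
  subst SN (sym (sub-as-subs (λ _ → refl) (λ _ → refl) (λ _ → refl) M))
        (Reducible⇒SN B (fundamental ⊢M E))
  where
  reducible : ∀ x → Reducible (Γ x) (toSubst σ x)
  reducible x with σ x in eq
  ... | nothing = var-Reducible (Γ x) x
  ... | just N with hyp x N eq
  ...   | Γx≡A , (_ , _ , ⊢N) , _ = subst (λ C → Reducible C N) (sym Γx≡A) (Typed⇒Reducible ⊢N)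

  E : RedSubst Γ Δ
  E = record { σ = toSubst σ ; κ = id ; τ = nilˢ ; σ-reducible = reducible ; τ-stacks = λ _ → right refl }
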